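{- For every $n\ge1$, the polytope $\mathcal{P}_{\delta_{n-1}}(n)$ is isomorphic (affinely equivalent) to the order polytope of the antichain $[n-1]$ on $n-1$ elements. Moreover $\mathcal{P}_{\delta_{n-1}}(n)$ has $2^{n-1}$ vertices and its normalized volume equals $(n-1)!$.
   Context: $\mathcal{A}(n)$ is the set of real $n\times n$ matrices $(a_{ij})$ with $0\le\sum_{i=1}^{i'}a_{ij}\le1$ for all $1\le i',j\le n$, $0\le\sum_{j=1}^{j'}a_{ij}\le1$ for all $1\le j',i\le n$, and all full row and column sums equal to $1$. $\delta_k=(k-1,k-2,\dots,1)$; a partition $\lambda=(\lambda_1,\dots,\lambda_k)\subseteq\delta_n$ (i.e. $\lambda_i\le n-i$) is identified with the set of matrix positions $\{(i,j):1\le i\le k,\ n-\lambda_i+1\le j\le n\}$. $\mathcal{P}_\lambda(n)=\{(a_{ij})\in\mathcal{A}(n):a_{ij}=0 \text{ whenever } i-j\ge2 \text{ and whenever }(i,j)\in\lambda\}$. For a finite poset $P$, $\mathcal{O}(P)=\{x\in[0,1]^P:x_s\le x_t\text{ whenever }s\le_Pt\}$. The normalized volume of an integral polytope is $\dim!$ times its relative volume (volume w.r.t. the lattice in its affine span).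
   Formalization: The polytope $\mathcal{P}_{\delta_{n-1}}(n)$ and the order polytope of the antichain consist of points with rational coordinates rather than real ones, and the affine equivalence is taken with rational coefficients. -}

module Defs where

open import Data.Nat as ℕ using (ℕ; zero; suc; _∸_; _!)
open import Data.Integer as ℤ using (ℤ; +_)
open import Data.Rational using (ℚ; 0ℚ; 1ℚ; _+_; _*_; _-_; _/_; ∣_∣; _≤_; _<_)
open import Data.Fin using (Fin; toℕ; fromℕ<)
open import Data.List using (List; []; _∷_; length; lookup)
open import Data.List.Relation.Unary.All using (All)
open import Data.List.Relation.Unary.Any using (Any)
open import Data.List.Relation.Unary.AllPairs using (AllPairs)
open import Data.Product using (Σ; _×_; ∃)
open import Relation.Binary.PropositionalEquality using (_≡_)
open import Relation.Nullary using (¬_)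

ℕtoℚ : ℕ → ℚ
ℕtoℚ m = + m / 1

sumFin : (d : ℕ) → (Fin d → ℚ) → ℚ
sumFin zero    f = 0ℚ
sumFin (suc d) f = f Data.Fin.zero + sumFin d (λ i → f (Data.Fin.suc i))

-- Points of ℚ^d and of ℚ^{n×n}.  Index i : Fin n stands for row/column i+1.
Vecℚ : ℕ → Set
Vecℚ d = Fin d → ℚ

Mat : ℕ → Set
Mat n = Fin n → Fin n → ℚ

VecEq : {d : ℕ} → Vecℚ d → Vecℚ d → Set
VecEq x y = ∀ i → x i ≡ y i

MatEq : {n : ℕ} → Mat n → Mat n → Set
MatEq a b = ∀ i j → a i j ≡ b i j

rowPrefix : {n : ℕ} → Mat n → Fin n → Fin n → ℚ
rowPrefix {n} a i j' = sumFin n (λ j → if≤ (toℕ j) (toℕ j') (a i j))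
  where
  if≤ : ℕ → ℕ → ℚ → ℚ
  if≤ m k q with m ℕ.≤? k
  ... | Relation.Nullary.yes _ = q
  ... | Relation.Nullary.no  _ = 0ℚ

colPrefix : {n : ℕ} → Mat n → Fin n → Fin n → ℚ
colPrefix {n} a i' j = sumFin n (λ i → if≤ (toℕ i) (toℕ i') (a i j))
  where
  if≤ : ℕ → ℕ → ℚ → ℚ
  if≤ m k q with m ℕ.≤? k
  ... | Relation.Nullary.yes _ = q
  ... | Relation.Nullary.no  _ = 0ℚ

InA : (n : ℕ) → Mat n → Set
InA n a =
  (∀ i' j → 0ℚ ≤ colPrefix a i' j × colPrefix a i' j ≤ 1ℚ) ×
  (∀ i j' → 0ℚ ≤ rowPrefix a i j' × rowPrefix a i j' ≤ 1ℚ) ×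
  (∀ i → sumFin n (λ j → a i j) ≡ 1ℚ) ×
  (∀ j → sumFin n (λ i → a i j) ≡ 1ℚ)

δ : ℕ → List ℕ
δ zero          = []
δ (suc zero)    = []
δ (suc (suc m)) = suc m ∷ δ (suc m)

-- (i,j) ∈ λ  (1-based: 1 ≤ i ≤ k and n - λ_i + 1 ≤ j ≤ n);
-- with 0-based i0 = toℕ i, j0 = toℕ j this reads i0 < k and n ≤ j0 + λ_{i0}.
InPartition : (λs : List ℕ) (n : ℕ) → Fin n → Fin n → Set
InPartition λs n i j =
  Σ (toℕ i ℕ.< length λs) (λ p → n ℕ.≤ toℕ j ℕ.+ lookup λs (fromℕ< p))

𝒫 : (λs : List ℕ) (n : ℕ) → Mat n → Set
𝒫 λs n a =
  InA n a ×
  (∀ i j → 2 ℕ.+ toℕ j ℕ.≤ toℕ i → a i j ≡ 0ℚ) ×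
  (∀ i j → InPartition λs n i j → a i j ≡ 0ℚ)

OrderPolytope : (m : ℕ) (_≤P_ : Fin m → Fin m → Set) → Vecℚ m → Set
OrderPolytope m _≤P_ x =
  (∀ s → 0ℚ ≤ x s × x s ≤ 1ℚ) × (∀ s t → s ≤P t → x s ≤ x t)

antichain : (m : ℕ) → Fin m → Fin m → Set
antichain m s t = s ≡ t

record AffMatToVec (n d : ℕ) : Set where
  field
    lin : Fin d → Fin n → Fin n → ℚ
    off : Fin d → ℚ

applyMV : {n d : ℕ} → AffMatToVec n d → Mat n → Vecℚ d
applyMV {n} f a k =
  sumFin n (λ i → sumFin n (λ j → AffMatToVec.lin f k i j * a i j))
  + AffMatToVec.off f k

record AffVecToMat (d n : ℕ) : Set where
  field
    lin : Fin n → Fin n → Fin d → ℚ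
    off : Fin n → Fin n → ℚ

applyVM : {d n : ℕ} → AffVecToMat d n → Vecℚ d → Mat n
applyVM {d} g x i j =
  sumFin d (λ k → AffVecToMat.lin g i j k * x k) + AffVecToMat.off g i j

AffinelyEquivalent : {n d : ℕ} → (Mat n → Set) → (Vecℚ d → Set) → Set
AffinelyEquivalent {n} {d} P Q =
  Σ (AffMatToVec n d) λ f → Σ (AffVecToMat d n) λ g →
    (∀ a → P a → Q (applyMV f a)) ×
    (∀ x → Q x → P (applyVM g x)) ×
    (∀ a → P a → MatEq (applyVM g (applyMV f a)) a) ×
    (∀ x → Q x → VecEq (applyMV f (applyVM g x)) x)

IsVertex : {n : ℕ} → (Mat n → Set) → Mat n → Set
IsVertex P v =
  P v ×
  (∀ y z (t : ℚ) → P y → P z → 0ℚ < t → t < 1ℚ →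
     MatEq v (λ i j → t * y i j + (1ℚ - t) * z i j) → MatEq y v)

NumVertices : {n : ℕ} → (Mat n → Set) → ℕ → Set
NumVertices P N =
  Σ (List _) λ vs →
    All (IsVertex P) vs ×
    AllPairs (λ v w → ¬ MatEq v w) vs ×
    (∀ v → IsVertex P v → Any (MatEq v) vs) ×
    length vs ≡ N

IntMat : ℕ → Set
IntMat n = Fin n → Fin n → ℤ

-- z ∈ (k+1)·P
InDilate : {n : ℕ} → (Mat n → Set) → ℕ → IntMat n → Set
InDilate P k z = P (λ i j → z i j / suc k)

LatticeCount : {n : ℕ} → (Mat n → Set) → ℕ → ℕ → Set
LatticeCount {n} P k N =
  Σ (List (IntMat n)) λ zs →
    All (InDilate P k) zs ×
    AllPairs (λ z w → ¬ (∀ i j → z i j ≡ w i j)) zs ×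
    (∀ z → InDilate P k z → Any (λ w → ∀ i j → z i j ≡ w i j) zs) ×
    length zs ≡ N

-- The relative volume of P (w.r.t. the lattice in its affine span) is r
-- and P has dimension D: r > 0 and #(tP ∩ ℤ^{n×n}) / t^D → r as t → ∞.
RelVolume : {n : ℕ} → (Mat n → Set) → ℕ → ℚ → Set
RelVolume P D r =
  0ℚ < r ×
  (∀ k → ∃ λ N → LatticeCount P k N) ×
  (∀ ε → 0ℚ < ε → ∃ λ K → ∀ k N → K ℕ.≤ k → LatticeCount P k N →
     ∣ ℕtoℚ N - r * ℕtoℚ (suc k ℕ.^ D) ∣ < ε * ℕtoℚ (suc k ℕ.^ D))

NormalizedVolume : {n : ℕ} → (Mat n → Set) → ℚ → Set
NormalizedVolume P v =
  Σ ℕ λ D → Σ ℚ λ r → RelVolume P D r × v ≡ ℕtoℚ (D !) * r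

-- A matrix in 𝒫_{δ_{n−1}}(n) vanishes outside the three central diagonals. Comparing the
-- sum of column c with that of row c shows, by induction on c, that it is symmetric; so it
-- is the tridiagonal matrix T(x) with off-diagonal entries x_r = a_{r,r+1} and diagonal
-- entries 1 − x_{r−1} − x_r. The partial row sums of T(x) are 0, x_{r−1}, 1 − x_r and 1,
-- so the remaining conditions say exactly that x lies in the cube [0,1]^{n−1}, which is the
-- order polytope of an antichain. Hence x ↦ T(x) is an affine bijection from the cube onto
-- the polytope. It sends the 0/1-vectors to the vertices and the grid {0,…,t}^{n−1}/t onto
-- the lattice points of t·𝒫, so there are 2^{n−1} vertices and (t+1)^{n−1} lattice points
-- in t·𝒫; the relative volume is therefore 1 and the normalized volume (n−1)!.

{-# OPTIONS --safe #-}
module Submission where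

open import Defs
open import Algebra.Bundles using (CommutativeRing)
open import Data.Nat as ℕ using (ℕ; zero; suc; _≤_; _<_; _≰_; _^_; _∸_; _!; z≤n; s≤s)
open import Data.Nat.Tactic.RingSolver using () renaming (solve-∀ to ℕ-solve-∀)
import Data.Nat.Properties as ℕ
open import Data.Fin as Fin using (Fin; toℕ; fromℕ<; inject₁)
import Data.Fin.Properties as Finₚ
open import Data.List using (List; []; _∷_; length; lookup; map; upTo; cartesianProductWith)
import Data.List.Properties as List
open import Data.List.Membership.Propositional using (_∈_)
import Data.List.Membership.Propositional.Properties as ∈
open import Data.List.Relation.Unary.All as All using (All; []; _∷_)
import Data.List.Relation.Unary.All.Properties as All
open import Data.List.Relation.Unary.Any as Any using (Any; here; there; _─_; index)
import Data.List.Relation.Unary.Any.Properties as Any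
open import Data.List.Relation.Unary.AllPairs as AllPairs using (AllPairs; []; _∷_)
import Data.List.Relation.Unary.AllPairs.Properties as AllPairs
import Data.List.Relation.Unary.Unique.Propositional.Properties as Unique
open import Data.Vec as Vec using (Vec; []; _∷_)
import Data.Vec.Properties as Vec
import Data.Vec.Relation.Unary.All as VecAll
import Data.Vec.Relation.Unary.All.Properties as VecAll
open import Data.Integer as ℤ using (ℤ)
import Data.Integer.Properties as ℤ
open import Data.Integer.Tactic.RingSolver using () renaming (solve-∀ to ℤ-solve-∀)
open import Data.Rational as ℚ using (ℚ; mkℚ; 0ℚ; 1ℚ; _+_; _*_; _-_; -_; _/_)
import Data.Rational.Properties as ℚ
open import Data.Rational.Unnormalised as ℚᵘ using (mkℚᵘ; *≡*; *≤*; *<*)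
import Data.Rational.Unnormalised.Properties as ℚᵘ
open import Data.Rational.Solver using (module +-*-Solver)
open import Data.Product using (Σ; ∃; _×_; _,_; proj₁; proj₂)
open import Data.Sum using (_⊎_; inj₁; inj₂)
open import Function using (_∘_; _∘′_; const)
open import Relation.Binary.PropositionalEquality
open import Relation.Binary.Definitions using (tri<; tri≈; tri>)
open import Relation.Nullary using (yes; no; ¬_; contradiction)

open import Algebra.Properties.Semiring.Sum (CommutativeRing.semiring ℚ.+-*-commutativeRing)
  using (sum; sum-syntax; sum-cong-≗; sum-init-last; sum-replicate-zero; ∑-distrib-+; *-distribˡ-sum)

open import Algebra.Properties.Group ℚ.+-0-group using () renaming (∙-cancelˡ to +-cancelˡ)
open +-*-Solver using (solve; _:+_; _:-_; _:*_; :-_; _:=_; con)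

sumFin≡sum : ∀ d (f : Fin d → ℚ) → sumFin d f ≡ sum f
sumFin≡sum zero    f = refl
sumFin≡sum (suc d) f = cong (λ s → f Fin.zero + s) (sumFin≡sum d (f ∘ Fin.suc))

sumBelow : ℕ → (ℕ → ℚ) → ℚ
sumBelow N F = ∑[ c < N ] F (toℕ c)

sumBelow-suc : ∀ N F → sumBelow (suc N) F ≡ sumBelow N F + F N
sumBelow-suc N F = trans (sum-init-last {N} (F ∘ toℕ))
  (cong₂ _+_ (sum-cong-≗ {N} (cong F ∘ Finₚ.toℕ-inject₁)) (cong F (Finₚ.toℕ-fromℕ N)))

sumBelow-cong : ∀ N {F G} → (∀ c → c < N → F c ≡ G c) → sumBelow N F ≡ sumBelow N G
sumBelow-cong N F≡G = sum-cong-≗ {N} (λ c → F≡G (toℕ c) (Finₚ.toℕ<n c))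

sumBelow-vanishing : ∀ N {F} → (∀ c → c < N → F c ≡ 0ℚ) → sumBelow N F ≡ 0ℚ
sumBelow-vanishing N F≡0 = trans (sumBelow-cong N F≡0) (sum-replicate-zero N)

sumBelow-cutoff : ∀ {K} N F → (∀ c → K ≤ c → F c ≡ 0ℚ) → K ≤ N →
                  sumBelow N F ≡ sumBelow K F
sumBelow-cutoff N F F≡0 K≤N with ℕ.m≤n⇒m<n∨m≡n K≤N
... | inj₂ refl = refl
sumBelow-cutoff {K} (suc N) F F≡0 _ | inj₁ K<1+N = begin
  sumBelow (suc N) F  ≡⟨ sumBelow-suc N F ⟩
  sumBelow N F + F N  ≡⟨ cong₂ _+_ (sumBelow-cutoff N F F≡0 K≤N) (F≡0 N K≤N) ⟩
  sumBelow K F + 0ℚ   ≡⟨ ℚ.+-identityʳ _ ⟩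
  sumBelow K F        ∎
  where open ≡-Reasoning
        K≤N = ℕ.m<1+n⇒m≤n K<1+N

sumBelow-linear : ∀ N u v (F G : ℕ → ℚ) {H} → (∀ c → H c ≡ u * F c + v * G c) →
                  sumBelow N H ≡ u * sumBelow N F + v * sumBelow N G
sumBelow-linear N u v F G {H} H≡ = begin
  sumBelow N H                                             ≡⟨ sumBelow-cong N (λ c _ → H≡ c) ⟩
  ∑[ c < N ] (u * F (toℕ c) + v * G (toℕ c))               ≡⟨ ∑-distrib-+ {N} _ _ ⟩
  ∑[ c < N ] (u * F (toℕ c)) + ∑[ c < N ] (v * G (toℕ c))
    ≡⟨ sym (cong₂ _+_ (*-distribˡ-sum {N} u _) (*-distribˡ-sum {N} v _)) ⟩
  u * sumBelow N F + v * sumBelow N G                      ∎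
  where open ≡-Reasoning

restrict≤ : ℕ → (ℕ → ℚ) → ℕ → ℚ
restrict≤ K F c with c ℕ.≤? K
... | yes _ = F c
... | no  _ = 0ℚ

sumBelow-restrict≤ : ∀ {K N} F → K < N → sumBelow N (restrict≤ K F) ≡ sumBelow (suc K) F
sumBelow-restrict≤ {K} {N} F K<N =
  trans (sumBelow-cutoff N (restrict≤ K F) outside K<N) (sumBelow-cong (suc K) inside)
  where
  outside : ∀ c → K < c → restrict≤ K F c ≡ 0ℚ
  outside c K<c with c ℕ.≤? K
  ... | yes c≤K = contradiction c≤K (ℕ.<⇒≱ K<c)
  ... | no  _   = refl
  inside : ∀ c → c < suc K → restrict≤ K F c ≡ F c
  inside c c<1+K with c ℕ.≤? K
  ... | yes _   = refl
  ... | no  c≰K = contradiction (ℕ.m<1+n⇒m≤n c<1+K) c≰K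

kronecker : ℕ → ℕ → ℚ
kronecker c k with c ℕ.≟ k
... | yes _ = 1ℚ
... | no  _ = 0ℚ

kronecker-refl : ∀ k → kronecker k k ≡ 1ℚ
kronecker-refl k with k ℕ.≟ k
... | yes _   = refl
... | no  k≢k = contradiction refl k≢k

kronecker-≢ : ∀ {c k} F → c ≢ k → kronecker c k * F ≡ 0ℚ
kronecker-≢ {c} {k} F c≢k with c ℕ.≟ k
... | yes c≡k = contradiction c≡k c≢k
... | no  _   = ℚ.*-zeroˡ F

sumBelow-kronecker : ∀ N k (F : ℕ → ℚ) → (N ≤ k → F k ≡ 0ℚ) →
                     sumBelow N (λ c → kronecker c k * F c) ≡ F k
sumBelow-kronecker N k F F≥N≡0 with k ℕ.<? N
... | no  k≮N = trans (sumBelow-vanishing N (λ c c<N → kronecker-≢ (F c) (ℕ.<⇒≢ (ℕ.<-≤-trans c<N N≤k))))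
                      (sym (F≥N≡0 N≤k))
  where N≤k = ℕ.≮⇒≥ k≮N
... | yes k<N = begin
  sumBelow N picked                        ≡⟨ sumBelow-cutoff N picked (λ c k<c → kronecker-≢ (F c) (ℕ.>⇒≢ k<c)) k<N ⟩
  sumBelow (suc k) picked                  ≡⟨ sumBelow-suc k picked ⟩
  sumBelow k picked + kronecker k k * F k  ≡⟨ cong₂ _+_ (sumBelow-vanishing k (λ c c<k → kronecker-≢ (F c) (ℕ.<⇒≢ c<k)))
                                                        (cong (_* F k) (kronecker-refl k)) ⟩
  0ℚ + 1ℚ * F k                            ≡⟨ trans (ℚ.+-identityˡ _) (ℚ.*-identityˡ (F k)) ⟩
  F k                                      ∎
  where
  open ≡-Reasoning
  picked : ℕ → ℚ
  picked c = kronecker c k * F c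

-- Matrices and points are extended by zero to ℕ-indexed families, so that arguments about
-- the band around the diagonal need no boundary cases.
extendBy : ∀ {A : Set} {d} → A → (Fin d → A) → ℕ → A
extendBy {d = zero}  z f c       = z
extendBy {d = suc d} z f zero    = f Fin.zero
extendBy {d = suc d} z f (suc c) = extendBy z (f ∘ Fin.suc) c

extendBy-toℕ : ∀ {A : Set} {d} (z : A) (f : Fin d → A) i → extendBy z f (toℕ i) ≡ f i
extendBy-toℕ z f Fin.zero    = refl
extendBy-toℕ z f (Fin.suc i) = extendBy-toℕ z (f ∘ Fin.suc) i

extendBy-≥ : ∀ {A : Set} {d c} (z : A) (f : Fin d → A) → d ≤ c → extendBy z f c ≡ z
extendBy-≥ {d = zero}              z f _         = refl
extendBy-≥ {d = suc d} {suc c} z f (s≤s d≤c) = extendBy-≥ z (f ∘ Fin.suc) d≤c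

extendBy-const : ∀ {A : Set} {d} (z : A) (f : Fin d → A) → (∀ i → f i ≡ z) →
                 ∀ c → extendBy z f c ≡ z
extendBy-const {d = zero}  z f f≡z c       = refl
extendBy-const {d = suc d} z f f≡z zero    = f≡z Fin.zero
extendBy-const {d = suc d} z f f≡z (suc c) = extendBy-const z (f ∘ Fin.suc) (f≡z ∘ Fin.suc) c

extendBy-preserves : ∀ {A : Set} {d} (P : A → Set) {z} {f : Fin d → A} → P z → (∀ i → P (f i)) →
                     ∀ c → P (extendBy z f c)
extendBy-preserves {d = zero}  P Pz Pf c       = Pz
extendBy-preserves {d = suc d} P Pz Pf zero    = Pf Fin.zero
extendBy-preserves {d = suc d} P Pz Pf (suc c) = extendBy-preserves P Pz (Pf ∘ Fin.suc) c

≗-belowAndBeyond : ∀ {A : Set} m {F G : ℕ → A} → (∀ (i : Fin m) → F (toℕ i) ≡ G (toℕ i)) →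
                   (∀ c → m ≤ c → F c ≡ G c) → ∀ c → F c ≡ G c
≗-belowAndBeyond m {F} {G} onFin beyond c with c ℕ.<? m
... | yes c<m = subst (λ c → F c ≡ G c) (Finₚ.toℕ-fromℕ< c<m) (onFin (fromℕ< c<m))
... | no  c≮m = beyond c (ℕ.≮⇒≥ c≮m)

extendBy-unique : ∀ {A : Set} {d} {z} {f : Fin d → A} {F : ℕ → A} →
                  (∀ i → f i ≡ F (toℕ i)) → (∀ c → d ≤ c → F c ≡ z) → ∀ c → extendBy z f c ≡ F c
extendBy-unique {d = d} {z} {f} f≡F F≥d≡z = ≗-belowAndBeyond d
  (λ i → trans (extendBy-toℕ z f i) (f≡F i))
  (λ c d≤c → trans (extendBy-≥ z f d≤c) (sym (F≥d≡z c d≤c)))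

extendBy-map : ∀ {A B : Set} {d} (h : A → B) {z z'} → h z ≡ z' → (f : Fin d → A) → ∀ c →
               h (extendBy z f c) ≡ extendBy z' (h ∘ f) c
extendBy-map {d = zero}  h hz≡z' f c       = hz≡z'
extendBy-map {d = suc d} h hz≡z' f zero    = refl
extendBy-map {d = suc d} h hz≡z' f (suc c) = extendBy-map h hz≡z' (f ∘ Fin.suc) c

extendBy-cong : ∀ {A : Set} {d} (z : A) {f g : Fin d → A} → (∀ i → f i ≡ g i) →
                ∀ c → extendBy z f c ≡ extendBy z g c
extendBy-cong {d = zero}  z f≗g c       = refl
extendBy-cong {d = suc d} z f≗g zero    = f≗g Fin.zero
extendBy-cong {d = suc d} z f≗g (suc c) = extendBy-cong z (f≗g ∘ Fin.suc) c

entry : ∀ {n} → Mat n → ℕ → ℕ → ℚ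
entry a r c = extendBy 0ℚ (λ i → extendBy 0ℚ (a i) c) r

entry-toℕ : ∀ {n} (a : Mat n) i j → entry a (toℕ i) (toℕ j) ≡ a i j
entry-toℕ a i j = trans (extendBy-toℕ 0ℚ _ i) (extendBy-toℕ 0ℚ (a i) j)

entry-cong : ∀ {n} {a b : Mat n} → MatEq a b → ∀ r c → entry a r c ≡ entry b r c
entry-cong a≡b r c = extendBy-cong 0ℚ (λ i → extendBy-cong 0ℚ (a≡b i) c) r

entry-row≥ : ∀ {n} (a : Mat n) {r} c → n ≤ r → entry a r c ≡ 0ℚ
entry-row≥ a c = extendBy-≥ 0ℚ _

entry-col≥ : ∀ {n} (a : Mat n) r {c} → n ≤ c → entry a r c ≡ 0ℚ
entry-col≥ a r n≤c = extendBy-const 0ℚ _ (λ i → extendBy-≥ 0ℚ (a i) n≤c) r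

entry-vanishes : ∀ {n} (a : Mat n) (P : ℕ → ℕ → Set) → (∀ i j → P (toℕ i) (toℕ j) → a i j ≡ 0ℚ) →
                 ∀ {r c} → P r c → entry a r c ≡ 0ℚ
entry-vanishes {n} a P a≡0 {r} {c} Prc with r ℕ.<? n | c ℕ.<? n
... | no  r≮n | _        = entry-row≥ a c (ℕ.≮⇒≥ r≮n)
... | yes _   | no  c≮n  = entry-col≥ a r (ℕ.≮⇒≥ c≮n)
... | yes r<n | yes c<n  = begin
  entry a r c                                    ≡⟨ cong₂ (entry a) r≡ c≡ ⟩
  entry a (toℕ (fromℕ< r<n)) (toℕ (fromℕ< c<n))  ≡⟨ entry-toℕ a _ _ ⟩
  a (fromℕ< r<n) (fromℕ< c<n)                    ≡⟨ a≡0 _ _ (subst₂ P r≡ c≡ Prc) ⟩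
  0ℚ                                             ∎
  where
  open ≡-Reasoning
  r≡ = sym (Finₚ.toℕ-fromℕ< r<n)
  c≡ = sym (Finₚ.toℕ-fromℕ< c<n)

_∈[0,1] : ℚ → Set
q ∈[0,1] = 0ℚ ℚ.≤ q × q ℚ.≤ 1ℚ

0∈[0,1] : 0ℚ ∈[0,1]
0∈[0,1] = ℚ.≤-refl , ℚ.nonNegative⁻¹ 1ℚ

1∈[0,1] : 1ℚ ∈[0,1]
1∈[0,1] = ℚ.nonNegative⁻¹ 1ℚ , ℚ.≤-refl

1-∈[0,1] : ∀ {q} → q ∈[0,1] → (1ℚ - q) ∈[0,1]
1-∈[0,1] {q} (0≤q , q≤1) =
  subst (ℚ._≤ 1ℚ - q) (ℚ.+-inverseʳ q) (ℚ.+-monoˡ-≤ (- q) q≤1) ,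
  subst (1ℚ - q ℚ.≤_) (ℚ.+-identityʳ 1ℚ) (ℚ.+-monoʳ-≤ 1ℚ (ℚ.neg-antimono-≤ 0≤q))

IsZeroOrOne : ℚ → Set
IsZeroOrOne q = q ≡ 0ℚ ⊎ q ≡ 1ℚ

isZeroOrOne⇒∈[0,1] : ∀ {q} → IsZeroOrOne q → q ∈[0,1]
isZeroOrOne⇒∈[0,1] (inj₁ refl) = 0∈[0,1]
isZeroOrOne⇒∈[0,1] (inj₂ refl) = 1∈[0,1]

≤∧≢⇒< : ∀ {p q} → p ℚ.≤ q → p ≢ q → p ℚ.< q
≤∧≢⇒< {p} {q} p≤q p≢q with ℚ.<-cmp p q
... | tri< p<q _ _ = p<q
... | tri≈ _ p≡q _ = contradiction p≡q p≢q
... | tri> _ _ q<p = contradiction (ℚ.≤-<-trans p≤q q<p) (ℚ.<-irrefl refl)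

nonNeg+nonNeg≡0⇒≡0 : ∀ {u v} → 0ℚ ℚ.≤ u → 0ℚ ℚ.≤ v → u + v ≡ 0ℚ → u ≡ 0ℚ
nonNeg+nonNeg≡0⇒≡0 {u} {v} 0≤u 0≤v u+v≡0 = ℚ.≤-antisym u≤0 0≤u
  where
  u≤0 : u ℚ.≤ 0ℚ
  u≤0 = subst (u ℚ.≤_) u+v≡0 (subst (ℚ._≤ u + v) (ℚ.+-identityʳ u) (ℚ.+-monoʳ-≤ u 0≤v))

nonNeg*nonNeg : ∀ {p q} → 0ℚ ℚ.≤ p → 0ℚ ℚ.≤ q → 0ℚ ℚ.≤ p * q
nonNeg*nonNeg {p} {q} 0≤p 0≤q = ℚ.nonNegative⁻¹ (p * q)
  {{ℚ.nonNeg*nonNeg⇒nonNeg p {{ℚ.nonNegative 0≤p}} q {{ℚ.nonNegative 0≤q}}}}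

pos*≡0⇒≡0 : ∀ {t p} → 0ℚ ℚ.< t → t * p ≡ 0ℚ → p ≡ 0ℚ
pos*≡0⇒≡0 {t} {p} 0<t tp≡0 = begin
  p                 ≡⟨ sym (ℚ.*-identityˡ p) ⟩
  1ℚ * p            ≡⟨ cong (_* p) (sym (ℚ.*-inverseˡ t)) ⟩
  ℚ.1/ t * t * p    ≡⟨ ℚ.*-assoc (ℚ.1/ t) t p ⟩
  ℚ.1/ t * (t * p)  ≡⟨ cong (ℚ.1/ t *_) tp≡0 ⟩
  ℚ.1/ t * 0ℚ       ≡⟨ ℚ.*-zeroʳ (ℚ.1/ t) ⟩
  0ℚ                ∎
  where
  open ≡-Reasoning
  instance
    t≢0 : ℚ.NonZero t
    t≢0 = ℚ.pos⇒nonZero t {{ℚ.positive 0<t}}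

convex≡0⇒≡0 : ∀ {t p q} → 0ℚ ℚ.< t → t ℚ.< 1ℚ → p ∈[0,1] → q ∈[0,1] →
              t * p + (1ℚ - t) * q ≡ 0ℚ → p ≡ 0ℚ
convex≡0⇒≡0 {t} {p} {q} 0<t t<1 (0≤p , _) (0≤q , _) combination≡0 =
  pos*≡0⇒≡0 0<t (nonNeg+nonNeg≡0⇒≡0 (nonNeg*nonNeg (ℚ.<⇒≤ 0<t) 0≤p)
                                    (nonNeg*nonNeg (proj₁ (1-∈[0,1] (ℚ.<⇒≤ 0<t , ℚ.<⇒≤ t<1))) 0≤q)
                                    combination≡0)

extreme-[0,1] : ∀ {b t p q} → IsZeroOrOne b → 0ℚ ℚ.< t → t ℚ.< 1ℚ → p ∈[0,1] → q ∈[0,1] →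
                b ≡ t * p + (1ℚ - t) * q → p ≡ b
extreme-[0,1] (inj₁ refl) 0<t t<1 p∈ q∈ b≡ = convex≡0⇒≡0 0<t t<1 p∈ q∈ (sym b≡)
extreme-[0,1] {t = t} {p} {q} (inj₂ refl) 0<t t<1 p∈ q∈ b≡ = begin
  p               ≡⟨ solve 1 (λ p → p := con 1ℚ :- (con 1ℚ :- p)) refl p ⟩
  1ℚ - (1ℚ - p)   ≡⟨ cong (λ s → 1ℚ - s)
                        (convex≡0⇒≡0 0<t t<1 (1-∈[0,1] p∈) (1-∈[0,1] q∈) mirrored) ⟩
  1ℚ - 0ℚ         ≡⟨ ℚ.+-identityʳ 1ℚ ⟩
  1ℚ              ∎
  where
  open ≡-Reasoning
  mirrored : t * (1ℚ - p) + (1ℚ - t) * (1ℚ - q) ≡ 0ℚ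
  mirrored = begin
    t * (1ℚ - p) + (1ℚ - t) * (1ℚ - q)
      ≡⟨ solve 3 (λ t p q → t :* (con 1ℚ :- p) :+ (con 1ℚ :- t) :* (con 1ℚ :- q)
                            := con 1ℚ :- (t :* p :+ (con 1ℚ :- t) :* q)) refl t p q ⟩
    1ℚ - (t * p + (1ℚ - t) * q)         ≡⟨ cong (λ s → 1ℚ - s) (sym b≡) ⟩
    1ℚ - 1ℚ                             ≡⟨ ℚ.+-inverseʳ 1ℚ ⟩
    0ℚ                                  ∎

toℚᵘ-/ : ∀ p k → ℚ.toℚᵘ (p / suc k) ℚᵘ.≃ mkℚᵘ p k
toℚᵘ-/ p k = ℚ.toℚᵘ-fromℚᵘ (mkℚᵘ p k)

/-injective : ∀ k {p q} → p / suc k ≡ q / suc k → p ≡ q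
/-injective k {p} {q} eq = ℤ.*-cancelʳ-≡ p q (ℤ.+ suc k) (ℚᵘ.drop-*≡*
  (ℚᵘ.≃-trans (ℚᵘ.≃-sym (toℚᵘ-/ p k)) (ℚᵘ.≃-trans (ℚ.toℚᵘ-cong eq) (toℚᵘ-/ q k))))

/-distrib-sub : ∀ k p q → (p ℤ.- q) / suc k ≡ p / suc k - q / suc k
/-distrib-sub k p q =
  ℚ.toℚᵘ-injective (ℚᵘ.≃-trans (toℚᵘ-/ (p ℤ.- q) k) (ℚᵘ.≃-trans sameDenominator (ℚᵘ.≃-sym homo)))
  where
  expand : ∀ p q d → (p ℤ.- q) ℤ.* (d ℤ.* d) ≡ (p ℤ.* d ℤ.+ (ℤ.- q) ℤ.* d) ℤ.* d
  expand = ℤ-solve-∀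
  sameDenominator : mkℚᵘ (p ℤ.- q) k ℚᵘ.≃ mkℚᵘ p k ℚᵘ.- mkℚᵘ q k
  sameDenominator = *≡* (trans (cong ((p ℤ.- q) ℤ.*_) (ℤ.pos-* (suc k) (suc k))) (expand p q (ℤ.+ suc k)))
  homo : ℚ.toℚᵘ (p / suc k - q / suc k) ℚᵘ.≃ mkℚᵘ p k ℚᵘ.- mkℚᵘ q k
  homo = ℚᵘ.≃-trans (ℚ.toℚᵘ-homo-+ (p / suc k) (ℚ.- (q / suc k)))
           (ℚᵘ.+-cong (toℚᵘ-/ p k) (ℚᵘ.≃-trans (ℚ.toℚᵘ-homo‿- (q / suc k)) (ℚᵘ.-‿cong (toℚᵘ-/ q k))))

n/n≡1 : ∀ k → ℤ.+ suc k / suc k ≡ 1ℚ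
n/n≡1 k = ℚ.toℚᵘ-injective (ℚᵘ.≃-trans (toℚᵘ-/ n k) (*≡* (trans (ℤ.*-identityʳ n) (sym (ℤ.*-identityˡ n)))))
  where n = ℤ.+ suc k

/∈[0,1]⁺ : ∀ k {v} → v ≤ suc k → (ℤ.+ v / suc k) ∈[0,1]
/∈[0,1]⁺ k {v} v≤1+k =
  ℚ.nonNegative⁻¹ (ℤ.+ v / suc k) {{ℚ.normalize-nonNeg v (suc k)}} ,
  ℚ.toℚᵘ-cancel-≤ (ℚᵘ.≤-respˡ-≃ (ℚᵘ.≃-sym (toℚᵘ-/ (ℤ.+ v) k)) (*≤* cross))
  where
  cross : ℤ.+ v ℤ.* ℤ.+ 1 ℤ.≤ ℤ.+ 1 ℤ.* ℤ.+ suc k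
  cross = subst₂ ℤ._≤_ (sym (ℤ.*-identityʳ (ℤ.+ v))) (sym (ℤ.*-identityˡ (ℤ.+ suc k))) (ℤ.+≤+ v≤1+k)

/∈[0,1]⁻ : ∀ k p → (p / suc k) ∈[0,1] → ∃ λ v → p ≡ ℤ.+ v × v ≤ suc k
/∈[0,1]⁻ k p (0≤p/n , p/n≤1) with nonNegative | atMostDenominator
  where
  nonNegative : ℤ.0ℤ ℤ.≤ p
  nonNegative = subst₂ ℤ._≤_ (ℤ.*-zeroˡ (ℤ.+ suc k)) (ℤ.*-identityʳ p)
                  (ℚᵘ.drop-*≤* (ℚᵘ.≤-respʳ-≃ (toℚᵘ-/ p k) (ℚ.toℚᵘ-mono-≤ 0≤p/n)))
  atMostDenominator : p ℤ.≤ ℤ.+ suc k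
  atMostDenominator = subst₂ ℤ._≤_ (ℤ.*-identityʳ p) (ℤ.*-identityˡ (ℤ.+ suc k))
                        (ℚᵘ.drop-*≤* (ℚᵘ.≤-respˡ-≃ (toℚᵘ-/ p k) (ℚ.toℚᵘ-mono-≤ p/n≤1)))
... | ℤ.+≤+ _ | v≤1+k = _ , refl , ℤ.drop‿+≤+ v≤1+k

-- NumVertices and LatticeCount unfold to instances of HasExactly.
HasExactly : {A : Set} → (A → A → Set) → (A → Set) → ℕ → Set
HasExactly {A} _≈_ S N = Σ (List A) λ xs →
  All S xs × AllPairs (λ x y → ¬ x ≈ y) xs × (∀ x → S x → Any (x ≈_) xs) × length xs ≡ N

HasExactly-map : ∀ {A B : Set} {_≈_ : A → A → Set} {S : A → Set} {T : B → Set} {N}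
                 (f : B → A) →
                 (∀ {b b'} → f b ≈ f b' → b ≡ b') → (∀ {b} → T b → S (f b)) →
                 (∀ {a} → S a → ∃ λ b → T b × a ≈ f b) →
                 HasExactly _≡_ T N → HasExactly _≈_ S N
HasExactly-map f f-injective sound complete (bs , T-bs , distinct , enumerates , length≡) =
  map f bs ,
  All.map⁺ (All.map sound T-bs) ,
  AllPairs.map⁺ (AllPairs.map (λ b≢b' fb≈fb' → b≢b' (f-injective fb≈fb')) distinct) ,
  (λ a Sa → let (b , Tb , a≈fb) = complete Sa
            in Any.map⁺ (Any.map (λ { refl → a≈fb }) (enumerates b Tb))) ,
  trans (List.length-map f bs) length≡

module Pigeonhole {A : Set} {_≈_ : A → A → Set}
  (≈-sym : ∀ {x y} → x ≈ y → y ≈ x) (≈-trans : ∀ {x y z} → x ≈ y → y ≈ z → x ≈ z) where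

  survives : ∀ {x x' ys} (p : Any (x ≈_) ys) → Any (x' ≈_) ys → ¬ x ≈ x' → Any (x' ≈_) (ys ─ p)
  survives (here x≈y) (here x'≈y) x≉x' = contradiction (≈-trans x≈y (≈-sym x'≈y)) x≉x'
  survives (here _)   (there q)   _    = q
  survives (there _)  (here x'≈y) _    = here x'≈y
  survives (there p)  (there q)   x≉x' = there (survives p q x≉x')

  length-≤ : ∀ {xs ys} → AllPairs (λ x y → ¬ x ≈ y) xs → All (λ x → Any (x ≈_) ys) xs →
             length xs ≤ length ys
  length-≤ {ys = ys} [] [] = z≤n
  length-≤ {x ∷ xs} {ys} (x≉xs ∷ distinct) (p ∷ ps) =
    subst (suc (length xs) ≤_) (sym (List.length-removeAt′ ys (index p)))
          (s≤s (length-≤ distinct (All.zipWith (λ (q , x≉x') → survives p q x≉x') (ps , x≉xs))))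

  HasExactly-unique : ∀ {S N N'} → HasExactly _≈_ S N → HasExactly _≈_ S N' → N ≡ N'
  HasExactly-unique (xs , S-xs , xs-distinct , xs-enum , refl) (ys , S-ys , ys-distinct , ys-enum , refl) =
    ℕ.≤-antisym (length-≤ xs-distinct (All.map (ys-enum _) S-xs))
                (length-≤ ys-distinct (All.map (xs-enum _) S-ys))

box : ∀ m (K : ℕ) → List (Vec ℕ m)
box zero    K = [] ∷ []
box (suc m) K = cartesianProductWith _∷_ (upTo (suc K)) (box m K)

length-cartesianProductWith : ∀ {A B C : Set} (f : A → B → C) xs ys →
                              length (cartesianProductWith f xs ys) ≡ length xs ℕ.* length ys
length-cartesianProductWith f []       ys = refl
length-cartesianProductWith f (x ∷ xs) ys =
  trans (List.length-++ (map (f x) ys))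
        (cong₂ ℕ._+_ (List.length-map (f x) ys) (length-cartesianProductWith f xs ys))

box-exactly : ∀ m K → HasExactly _≡_ (VecAll.All (_≤ K)) (suc K ^ m)
box-exactly m K = box m K , All.tabulate (bounded m) , unique m , (λ w w≤K → complete m w≤K) , length-box m
  where
  bounded : ∀ m {w} → w ∈ box m K → VecAll.All (_≤ K) w
  bounded zero    (here refl) = VecAll.[]
  bounded (suc m) w∈ with ∈.∈-cartesianProductWith⁻ _∷_ (upTo (suc K)) (box m K) w∈
  ... | v , w' , v∈ , w'∈ , refl = ℕ.≤-pred (∈.∈-upTo⁻ v∈) VecAll.∷ bounded m w'∈

  unique : ∀ m → AllPairs _≢_ (box m K)
  unique zero    = [] ∷ []
  unique (suc m) = Unique.cartesianProductWith⁺ _∷_ Vec.∷-injective (Unique.upTo⁺ (suc K)) (unique m)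

  complete : ∀ m {w} → VecAll.All (_≤ K) w → Any (w ≡_) (box m K)
  complete zero    VecAll.[]            = here refl
  complete (suc m) (v≤K VecAll.∷ w≤K) =
    ∈.∈-cartesianProductWith⁺ _∷_ (∈.∈-upTo⁺ (s≤s v≤K)) (complete m w≤K)

  length-box : ∀ m → length (box m K) ≡ suc K ^ m
  length-box zero    = refl
  length-box (suc m) = trans (length-cartesianProductWith _∷_ (upTo (suc K)) (box m K))
                             (cong₂ ℕ._*_ (List.length-upTo (suc K)) (length-box m))

pow-suc-bound : ∀ a m → 1 ≤ a → a ℕ.* suc a ^ m ≤ a ^ m ℕ.* (a ℕ.+ 3 ^ m)
pow-suc-bound a zero    _   = begin
  a ℕ.* 1          ≡⟨ ℕ.*-identityʳ a ⟩
  a                ≤⟨ ℕ.m≤m+n a 1 ⟩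
  a ℕ.+ 1          ≡⟨ sym (ℕ.*-identityˡ (a ℕ.+ 1)) ⟩
  1 ℕ.* (a ℕ.+ 1)  ∎
  where open ℕ.≤-Reasoning
pow-suc-bound a (suc m) 1≤a = begin
  a ℕ.* ((1 ℕ.+ a) ℕ.* S)                                    ≡⟨ swap a S ⟩
  (1 ℕ.+ a) ℕ.* (a ℕ.* S)                                    ≤⟨ ℕ.*-monoʳ-≤ (1 ℕ.+ a) (pow-suc-bound a m 1≤a) ⟩
  (1 ℕ.+ a) ℕ.* (A ℕ.* (a ℕ.+ T))                            ≡⟨ expand a A T ⟩
  A ℕ.* (a ℕ.* a) ℕ.+ A ℕ.* (a ℕ.+ T ℕ.* a ℕ.+ T)            ≤⟨ ℕ.+-monoʳ-≤ (A ℕ.* (a ℕ.* a)) (ℕ.*-monoʳ-≤ A slack) ⟩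
  A ℕ.* (a ℕ.* a) ℕ.+ A ℕ.* (T ℕ.* a ℕ.+ T ℕ.* a ℕ.+ T ℕ.* a) ≡⟨ collect a A T ⟩
  a ℕ.* A ℕ.* (a ℕ.+ 3 ℕ.* T)                                ∎
  where
  open ℕ.≤-Reasoning
  S = suc a ^ m
  A = a ^ m
  T = 3 ^ m
  swap : ∀ a S → a ℕ.* ((1 ℕ.+ a) ℕ.* S) ≡ (1 ℕ.+ a) ℕ.* (a ℕ.* S)
  swap = ℕ-solve-∀
  expand : ∀ a A T → (1 ℕ.+ a) ℕ.* (A ℕ.* (a ℕ.+ T)) ≡
                     A ℕ.* (a ℕ.* a) ℕ.+ A ℕ.* (a ℕ.+ T ℕ.* a ℕ.+ T)
  expand = ℕ-solve-∀
  collect : ∀ a A T → A ℕ.* (a ℕ.* a) ℕ.+ A ℕ.* (T ℕ.* a ℕ.+ T ℕ.* a ℕ.+ T ℕ.* a) ≡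
                      a ℕ.* A ℕ.* (a ℕ.+ 3 ℕ.* T)
  collect = ℕ-solve-∀
  slack : a ℕ.+ T ℕ.* a ℕ.+ T ≤ T ℕ.* a ℕ.+ T ℕ.* a ℕ.+ T ℕ.* a
  slack = ℕ.+-mono-≤ (ℕ.+-monoˡ-≤ (T ℕ.* a) (ℕ.m≤n*m a T {{ℕ.>-nonZero (ℕ.m^n>0 3 m)}}))
                     (ℕ.≤-trans (ℕ.≤-reflexive (sym (ℕ.*-identityʳ T))) (ℕ.*-monoʳ-≤ T 1≤a))

pow-suc-gap : ∀ m q k → q ℕ.* 3 ^ m ≤ k → (suc (suc k) ^ m ∸ suc k ^ m) ℕ.* q < suc k ^ m
pow-suc-gap m q k q3^m≤k = ℕ.*-cancelˡ-< a (D ℕ.* q) A (begin-strict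
  a ℕ.* (D ℕ.* q)    ≡⟨ sym (ℕ.*-assoc a D q) ⟩
  a ℕ.* D ℕ.* q      ≤⟨ ℕ.*-monoˡ-≤ q aD≤TA ⟩
  T ℕ.* A ℕ.* q      ≡⟨ rotate T A q ⟩
  q ℕ.* T ℕ.* A      ≤⟨ ℕ.*-monoˡ-≤ A q3^m≤k ⟩
  k ℕ.* A            <⟨ ℕ.m<n+m (k ℕ.* A) (ℕ.m^n>0 a m) ⟩
  a ℕ.* A            ∎)
  where
  open ℕ.≤-Reasoning
  a = suc k
  A = a ^ m
  T = 3 ^ m
  D = suc a ^ m ∸ A
  rotate : ∀ T A q → T ℕ.* A ℕ.* q ≡ q ℕ.* T ℕ.* A
  rotate = ℕ-solve-∀
  distribute : ∀ a A T → A ℕ.* (a ℕ.+ T) ≡ a ℕ.* A ℕ.+ T ℕ.* A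
  distribute = ℕ-solve-∀
  aD≤TA : a ℕ.* D ≤ T ℕ.* A
  aD≤TA = begin
    a ℕ.* (suc a ^ m ∸ A)              ≡⟨ ℕ.*-distribˡ-∸ a (suc a ^ m) A ⟩
    a ℕ.* suc a ^ m ∸ a ℕ.* A          ≤⟨ ℕ.∸-monoˡ-≤ (a ℕ.* A) (pow-suc-bound a m (s≤s z≤n)) ⟩
    A ℕ.* (a ℕ.+ T) ∸ a ℕ.* A          ≡⟨ cong (_∸ a ℕ.* A) (distribute a A T) ⟩
    a ℕ.* A ℕ.+ T ℕ.* A ∸ a ℕ.* A      ≡⟨ ℕ.m+n∸m≡n (a ℕ.* A) (T ℕ.* A) ⟩
    T ℕ.* A                            ∎

ℕtoℚ-∸ : ∀ {A B} → A ≤ B → ℕtoℚ B - ℕtoℚ A ≡ ℕtoℚ (B ∸ A)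
ℕtoℚ-∸ {A} {B} A≤B =
  trans (sym (/-distrib-sub 0 (ℤ.+ B) (ℤ.+ A))) (cong (_/ 1) (trans (ℤ.m-n≡m⊖n B A) (ℤ.⊖-≥ A≤B)))

-- ε ≥ 1/↧ε since the numerator of ε is at least 1.
ℕtoℚ<ε* : ∀ {ε} → 0ℚ ℚ.< ε → ∀ D A → D ℕ.* ℚ.↧ₙ ε < A → ℕtoℚ D ℚ.< ε * ℕtoℚ A
ℕtoℚ<ε* {mkℚ (ℤ.+ 0)      _ _} (ℚ.*<* (ℤ.+<+ ()))
ℕtoℚ<ε* {mkℚ ℤ.-[1+ _ ]   _ _} (ℚ.*<* ())
ℕtoℚ<ε* {ε@(mkℚ (ℤ.+ suc p) d-1 _)} _ D A D↧ε<A = ℚ.toℚᵘ-cancel-<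
  (ℚᵘ.<-respˡ-≃ (ℚᵘ.≃-sym (toℚᵘ-/ (ℤ.+ D) 0)) (ℚᵘ.<-respʳ-≃ (ℚᵘ.≃-sym product) fractions))
  where
  product : ℚ.toℚᵘ (ε * ℕtoℚ A) ℚᵘ.≃ mkℚᵘ (ℤ.+ suc p) d-1 ℚᵘ.* mkℚᵘ (ℤ.+ A) 0
  product = ℚᵘ.≃-trans (ℚ.toℚᵘ-homo-* ε (ℕtoℚ A))
                       (ℚᵘ.*-cong (ℚᵘ.≃-refl {mkℚᵘ (ℤ.+ suc p) d-1}) (toℚᵘ-/ (ℤ.+ A) 0))
  naturals : D ℕ.* suc (d-1 ℕ.* 1) < suc p ℕ.* A ℕ.* 1
  naturals = subst₂ (λ u v → D ℕ.* suc u < v) (sym (ℕ.*-identityʳ d-1)) (sym (ℕ.*-identityʳ (suc p ℕ.* A)))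
                    (ℕ.<-≤-trans D↧ε<A (ℕ.m≤n*m A (suc p)))
  fractions : mkℚᵘ (ℤ.+ D) 0 ℚᵘ.< mkℚᵘ (ℤ.+ suc p) d-1 ℚᵘ.* mkℚᵘ (ℤ.+ A) 0
  fractions = *<* (subst₂ ℤ._<_ (ℤ.pos-* D (suc (d-1 ℕ.* 1)))
                               (trans (ℤ.pos-* (suc p ℕ.* A) 1) (cong (ℤ._* ℤ.+ 1) (ℤ.pos-* (suc p) A)))
                               (ℤ.+<+ naturals))

data Band : ℕ → ℕ → Set where
  diagonal : ∀ r → Band r r
  super    : ∀ r → Band r (suc r)
  sub      : ∀ c → Band (suc c) c
  above    : ∀ {r c} → 2 ℕ.+ r ≤ c → Band r c
  below    : ∀ {r c} → 2 ℕ.+ c ≤ r → Band r c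

band : ∀ r c → Band r c
band r c with ℕ.<-cmp r c
... | tri≈ _ refl _ = diagonal r
... | tri< r<c _ _ with suc r ℕ.≟ c
...   | yes refl = super r
...   | no  1+r≢c = above (ℕ.≤∧≢⇒< r<c 1+r≢c)
band r c | tri> _ _ c<r with suc c ℕ.≟ r
...   | yes refl = sub c
...   | no  1+c≢r = below (ℕ.≤∧≢⇒< c<r 1+c≢r)

2+n≰n : ∀ n → 2 ℕ.+ n ≰ n
2+n≰n n 2+n≤n = ℕ.1+n≰n (ℕ.≤-trans (ℕ.n≤1+n (suc n)) 2+n≤n)

2+n≰1+n : ∀ n → 2 ℕ.+ n ≰ 1 ℕ.+ n
2+n≰1+n n = ℕ.1+n≰n ∘′ ℕ.≤-pred

-- total is the common row sum of tridiag x: 1 for the points of 𝒫, and k+1 for the integer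
-- points of (k+1)·𝒫.
module Tridiagonal {A : Set} (0# total : A) (_-_ : A → A → A) where

  previous : (ℕ → A) → ℕ → A
  previous x zero    = 0#
  previous x (suc r) = x r

  entryAt : (ℕ → A) → ∀ {r c} → Band r c → A
  entryAt x (diagonal r) = (total - previous x r) - x r
  entryAt x (super r)    = x r
  entryAt x (sub c)      = x c
  entryAt x (above _)    = 0#
  entryAt x (below _)    = 0#

  tridiag : (ℕ → A) → ℕ → ℕ → A
  tridiag x r c = entryAt x (band r c)

  tridiag-diagonal : ∀ x r → tridiag x r r ≡ (total - previous x r) - x r
  tridiag-diagonal x r = at (band r r)
    where
    at : (b : Band r r) → entryAt x b ≡ (total - previous x r) - x r
    at (diagonal _)  = refl
    at (above 2+r≤r) = contradiction 2+r≤r (2+n≰n r)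
    at (below 2+r≤r) = contradiction 2+r≤r (2+n≰n r)

  tridiag-super : ∀ x r → tridiag x r (suc r) ≡ x r
  tridiag-super x r = at (band r (suc r))
    where
    at : (b : Band r (suc r)) → entryAt x b ≡ x r
    at (super _)       = refl
    at (above 2+r≤1+r) = contradiction 2+r≤1+r (2+n≰1+n r)
    at (below 3+r≤r)   = contradiction (ℕ.≤-trans (ℕ.n≤1+n _) 3+r≤r) (2+n≰n r)

  tridiag-sub : ∀ x c → tridiag x (suc c) c ≡ x c
  tridiag-sub x c = at (band (suc c) c)
    where
    at : (b : Band (suc c) c) → entryAt x b ≡ x c
    at (sub _)         = refl
    at (above 3+c≤c)   = contradiction (ℕ.≤-trans (ℕ.n≤1+n _) 3+c≤c) (2+n≰n c)
    at (below 2+c≤1+c) = contradiction 2+c≤1+c (2+n≰1+n c)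

  tridiag-above : ∀ x {r c} → 2 ℕ.+ r ≤ c → tridiag x r c ≡ 0#
  tridiag-above x {r} {c} 2+r≤c = at (band r c)
    where
    at : (b : Band r c) → entryAt x b ≡ 0#
    at (diagonal _) = contradiction 2+r≤c (2+n≰n r)
    at (super _)    = contradiction 2+r≤c (2+n≰1+n r)
    at (sub _)      = contradiction (ℕ.≤-trans (ℕ.n≤1+n _) 2+r≤c) (2+n≰n c)
    at (above _)    = refl
    at (below _)    = refl

  tridiag-below : ∀ x {r c} → 2 ℕ.+ c ≤ r → tridiag x r c ≡ 0#
  tridiag-below x {r} {c} 2+c≤r = at (band r c)
    where
    at : (b : Band r c) → entryAt x b ≡ 0#
    at (diagonal _) = contradiction 2+c≤r (2+n≰n c)
    at (super _)    = contradiction (ℕ.≤-trans (ℕ.n≤1+n _) 2+c≤r) (2+n≰n r)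
    at (sub _)      = contradiction 2+c≤r (2+n≰1+n c)
    at (above _)    = refl
    at (below _)    = refl

  tridiag-cong : ∀ {x y} → (∀ c → x c ≡ y c) → ∀ r c → tridiag x r c ≡ tridiag y r c
  tridiag-cong {x} {y} x≗y r c = at (band r c)
    where
    at : ∀ {r c} (b : Band r c) → entryAt x b ≡ entryAt y b
    at (diagonal r) = cong₂ _-_ (cong (λ p → total - p) (previous-cong r)) (x≗y r)
      where
      previous-cong : ∀ r → previous x r ≡ previous y r
      previous-cong zero    = refl
      previous-cong (suc r) = x≗y r
    at (super r) = x≗y r
    at (sub c)   = x≗y c
    at (above _) = refl
    at (below _) = refl

  tridiag-sym : ∀ x r c → tridiag x r c ≡ tridiag x c r
  tridiag-sym x r c = at (band r c)
    where
    at : ∀ {r c} (b : Band r c) → entryAt x b ≡ tridiag x c r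
    at (diagonal r)  = sym (tridiag-diagonal x r)
    at (super r)     = sym (tridiag-sub x r)
    at (sub c)       = sym (tridiag-super x c)
    at (above 2+r≤c) = sym (tridiag-below x 2+r≤c)
    at (below 2+c≤r) = sym (tridiag-above x 2+c≤r)

open Tridiagonal 0ℚ 1ℚ _-_

record NearDiagonal (r : ℕ) (F : ℕ → ℚ) : Set where
  field
    left-zero  : ∀ {c} → 2 ℕ.+ c ≤ r → F c ≡ 0ℚ
    right-zero : ∀ {c} → 2 ℕ.+ r ≤ c → F c ≡ 0ℚ

sumBelow-toDiagonal : ∀ {r F} → NearDiagonal r F → sumBelow r F ≡ previous F r
sumBelow-toDiagonal {zero}      near = refl
sumBelow-toDiagonal {suc r} {F} near = begin
  sumBelow (suc r) F ≡⟨ sumBelow-suc r F ⟩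
  sumBelow r F + F r ≡⟨ cong (_+ F r) (sumBelow-vanishing r (λ _ c<r → left-zero (s≤s c<r))) ⟩
  0ℚ + F r           ≡⟨ ℚ.+-identityˡ (F r) ⟩
  F r                ∎
  where open ≡-Reasoning
        open NearDiagonal near

sumBelow-beforeDiagonal : ∀ {r F N} → NearDiagonal r F → N < r → sumBelow N F ≡ 0ℚ
sumBelow-beforeDiagonal {N = N} near N<r =
  sumBelow-vanishing N (λ _ c<N → NearDiagonal.left-zero near (ℕ.≤-trans (s≤s c<N) N<r))

sumBelow-pastDiagonal : ∀ {r F N} → NearDiagonal r F → 2 ℕ.+ r ≤ N →
                        sumBelow N F ≡ previous F r + F r + F (suc r)
sumBelow-pastDiagonal {r} {F} {N} near 2+r≤N = begin
  sumBelow N F                       ≡⟨ sumBelow-cutoff N F (λ _ → right-zero) 2+r≤N ⟩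
  sumBelow (2 ℕ.+ r) F               ≡⟨ sumBelow-suc (suc r) F ⟩
  sumBelow (suc r) F + F (suc r)     ≡⟨ cong (_+ F (suc r)) (sumBelow-suc r F) ⟩
  sumBelow r F + F r + F (suc r)     ≡⟨ cong (λ s → s + F r + F (suc r)) (sumBelow-toDiagonal near) ⟩
  previous F r + F r + F (suc r)     ∎
  where open ≡-Reasoning
        open NearDiagonal near

sumBelow-wholeBand : ∀ {r F} N → NearDiagonal r F → (∀ c → N ≤ c → F c ≡ 0ℚ) →
                     sumBelow N F ≡ previous F r + F r + F (suc r)
sumBelow-wholeBand {r} {F} N near F≥N≡0 with ℕ.≤-total N (2 ℕ.+ r)
... | inj₁ N≤2+r =
  trans (sym (sumBelow-cutoff (2 ℕ.+ r) F F≥N≡0 N≤2+r)) (sumBelow-pastDiagonal near ℕ.≤-refl)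
... | inj₂ 2+r≤N = sumBelow-pastDiagonal near 2+r≤N

tridiag-nearDiagonal : ∀ x r → NearDiagonal r (tridiag x r)
tridiag-nearDiagonal x r = record { left-zero = tridiag-below x ; right-zero = tridiag-above x }

previous-tridiag : ∀ x r → previous (tridiag x r) r ≡ previous x r
previous-tridiag x zero    = refl
previous-tridiag x (suc r) = tridiag-sub x r

tridiag-wholeRow : ∀ x r → previous (tridiag x r) r + tridiag x r r + tridiag x r (suc r) ≡ 1ℚ
tridiag-wholeRow x r = begin
  previous (tridiag x r) r + tridiag x r r + tridiag x r (suc r)
    ≡⟨ cong₂ (λ p d → p + d + tridiag x r (suc r)) (previous-tridiag x r) (tridiag-diagonal x r) ⟩
  previous x r + (1ℚ - previous x r - x r) + tridiag x r (suc r)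
    ≡⟨ cong (previous x r + (1ℚ - previous x r - x r) +_) (tridiag-super x r) ⟩
  previous x r + (1ℚ - previous x r - x r) + x r
    ≡⟨ solve 2 (λ p y → p :+ (con 1ℚ :- p :- y) :+ y := con 1ℚ) refl (previous x r) (x r) ⟩
  1ℚ ∎
  where open ≡-Reasoning

tridiag-rowSum : ∀ {m x} → (∀ c → m ≤ c → x c ≡ 0ℚ) → ∀ {r} → r ≤ m →
                 sumBelow (suc m) (tridiag x r) ≡ 1ℚ
tridiag-rowSum {m} {x} x≥m≡0 {r} r≤m =
  trans (sumBelow-wholeBand (suc m) (tridiag-nearDiagonal x r) beyond) (tridiag-wholeRow x r)
  where
  beyond : ∀ c → suc m ≤ c → tridiag x r c ≡ 0ℚ
  beyond c 1+m≤c with ℕ.m≤n⇒m<n∨m≡n (ℕ.≤-trans (s≤s r≤m) 1+m≤c)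
  ... | inj₁ 2+r≤c  = tridiag-above x 2+r≤c
  ... | inj₂ refl   = trans (tridiag-super x r) (x≥m≡0 r (ℕ.≤-pred 1+m≤c))

tridiag-prefix∈[0,1] : ∀ {x} → (∀ c → x c ∈[0,1]) → ∀ r c' →
                       sumBelow (suc c') (tridiag x r) ∈[0,1]
tridiag-prefix∈[0,1] {x} x∈[0,1] r c' = at (band r c')
  where
  throughSuper : ∀ r {N} → 2 ℕ.+ r ≤ N → sumBelow N (tridiag x r) ≡ 1ℚ
  throughSuper r 2+r≤N =
    trans (sumBelow-pastDiagonal (tridiag-nearDiagonal x r) 2+r≤N) (tridiag-wholeRow x r)

  at : ∀ {r c'} → Band r c' → sumBelow (suc c') (tridiag x r) ∈[0,1]
  at (diagonal r) = subst _∈[0,1] (sym upToDiagonal) (1-∈[0,1] (x∈[0,1] r))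
    where
    upToDiagonal : sumBelow (suc r) (tridiag x r) ≡ 1ℚ - x r
    upToDiagonal = begin
      sumBelow (suc r) (tridiag x r)            ≡⟨ sumBelow-suc r (tridiag x r) ⟩
      sumBelow r (tridiag x r) + tridiag x r r  ≡⟨ cong₂ _+_ previous≡ (tridiag-diagonal x r) ⟩
      previous x r + (1ℚ - previous x r - x r)  ≡⟨ solve 2 (λ p y → p :+ (con 1ℚ :- p :- y) := con 1ℚ :- y)
                                                         refl (previous x r) (x r) ⟩
      1ℚ - x r                                  ∎
      where
      open ≡-Reasoning
      previous≡ = trans (sumBelow-toDiagonal (tridiag-nearDiagonal x r)) (previous-tridiag x r)
  at (super r)       = subst _∈[0,1] (sym (throughSuper r ℕ.≤-refl)) 1∈[0,1]
  at (sub c)         = subst _∈[0,1] (sym (trans (sumBelow-toDiagonal (tridiag-nearDiagonal x (suc c)))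
                                                 (tridiag-sub x c)))
                             (x∈[0,1] c)
  at (above {r} 2+r≤c') = subst _∈[0,1] (sym (throughSuper r (ℕ.m≤n⇒m≤1+n 2+r≤c'))) 1∈[0,1]
  at (below {r} 2+c'≤r) =
    subst _∈[0,1] (sym (sumBelow-beforeDiagonal (tridiag-nearDiagonal x r) 2+c'≤r)) 0∈[0,1]

tridiag-convex : ∀ t {x y z} → (∀ c → x c ≡ t * y c + (1ℚ - t) * z c) →
                 ∀ r c → tridiag x r c ≡ t * tridiag y r c + (1ℚ - t) * tridiag z r c
tridiag-convex t {x} {y} {z} x≡ r c = at (band r c)
  where
  combination-of-zeros : 0ℚ ≡ t * 0ℚ + (1ℚ - t) * 0ℚ
  combination-of-zeros = solve 1 (λ t → con 0ℚ := t :* con 0ℚ :+ (con 1ℚ :- t) :* con 0ℚ) refl t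

  previous-convex : ∀ r → previous x r ≡ t * previous y r + (1ℚ - t) * previous z r
  previous-convex zero    = combination-of-zeros
  previous-convex (suc r) = x≡ r

  at : ∀ {r c} (b : Band r c) → entryAt x b ≡ t * entryAt y b + (1ℚ - t) * entryAt z b
  at (diagonal r) = trans (cong₂ (λ p d → 1ℚ - p - d) (previous-convex r) (x≡ r))
    (solve 5 (λ t p q d e → con 1ℚ :- (t :* p :+ (con 1ℚ :- t) :* q) :- (t :* d :+ (con 1ℚ :- t) :* e)
                            := t :* (con 1ℚ :- p :- d) :+ (con 1ℚ :- t) :* (con 1ℚ :- q :- e))
           refl t (previous y r) (previous z r) (y r) (z r))
  at (super r) = x≡ r
  at (sub c)   = x≡ c
  at (above _) = combination-of-zeros
  at (below _) = combination-of-zeros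

superdiagonal : ∀ {n} → Mat n → ℕ → ℚ
superdiagonal a c = entry a c (suc c)

superdiagonal-≥ : ∀ {m} (a : Mat (suc m)) {c} → m ≤ c → superdiagonal a c ≡ 0ℚ
superdiagonal-≥ a {c} m≤c = entry-col≥ a c (s≤s m≤c)

superdiagonal-inject₁ : ∀ {m} (a : Mat (suc m)) (k : Fin m) →
                        superdiagonal a (toℕ k) ≡ a (inject₁ k) (Fin.suc k)
superdiagonal-inject₁ a k = trans (cong (λ r → entry a r (suc (toℕ k))) (sym (Finₚ.toℕ-inject₁ k)))
                                  (entry-toℕ a (inject₁ k) (Fin.suc k))

tridiagMatrix : ∀ {n} → (ℕ → ℚ) → Mat n
tridiagMatrix x i j = tridiag x (toℕ i) (toℕ j)

superdiagonal-tridiagMatrix : ∀ {m x} → (∀ c → m ≤ c → x c ≡ 0ℚ) →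
                              ∀ c → superdiagonal (tridiagMatrix {suc m} x) c ≡ x c
superdiagonal-tridiagMatrix {m} {x} x≥m≡0 = ≗-belowAndBeyond m onFin
  (λ c m≤c → trans (superdiagonal-≥ (tridiagMatrix {suc m} x) m≤c) (sym (x≥m≡0 c m≤c)))
  where
  onFin : ∀ (k : Fin m) → superdiagonal (tridiagMatrix {suc m} x) (toℕ k) ≡ x (toℕ k)
  onFin k = trans (superdiagonal-inject₁ (tridiagMatrix x) k)
                  (trans (cong (λ r → tridiag x r (suc (toℕ k))) (Finₚ.toℕ-inject₁ k)) (tridiag-super x (toℕ k)))

tridiagMatrix-injective : ∀ {m x y} → (∀ c → m ≤ c → x c ≡ 0ℚ) → (∀ c → m ≤ c → y c ≡ 0ℚ) →
                          MatEq (tridiagMatrix {suc m} x) (tridiagMatrix y) → ∀ c → x c ≡ y c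
tridiagMatrix-injective x≥m≡0 y≥m≡0 x≡y c = trans (sym (superdiagonal-tridiagMatrix x≥m≡0 c))
  (trans (entry-cong x≡y c (suc c)) (superdiagonal-tridiagMatrix y≥m≡0 c))

module SumsOf {n} (a : Mat n) (A : ℕ → ℕ → ℚ) (a≡A : ∀ i j → a i j ≡ A (toℕ i) (toℕ j)) where

  rowSum≡ : ∀ i → sumFin n (λ j → a i j) ≡ sumBelow n (A (toℕ i))
  rowSum≡ i = trans (sumFin≡sum n (a i)) (sum-cong-≗ {n} (a≡A i))

  colSum≡ : ∀ j → sumFin n (λ i → a i j) ≡ sumBelow n (λ r → A r (toℕ j))
  colSum≡ j = trans (sumFin≡sum n (λ i → a i j)) (sum-cong-≗ {n} (λ i → a≡A i j))

  -- The integrand of rowPrefix and colPrefix is local to Defs; the mutual blocks let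
  -- unification name it.
  mutual
    rowPrefix≡ : ∀ i j' → rowPrefix a i j' ≡ sumBelow (suc (toℕ j')) (A (toℕ i))
    rowPrefix≡ i j' = trans (sumFin≡sum n _)
      (trans (sum-cong-≗ {n} (rowPrefix-term i j')) (sumBelow-restrict≤ (A (toℕ i)) (Finₚ.toℕ<n j')))

    rowPrefix-term : ∀ i j' j → _ ≡ restrict≤ (toℕ j') (A (toℕ i)) (toℕ j)
    rowPrefix-term i j' j with toℕ j ℕ.≤? toℕ j'
    ... | yes _ = a≡A i j
    ... | no  _ = refl

  mutual
    colPrefix≡ : ∀ i' j → colPrefix a i' j ≡ sumBelow (suc (toℕ i')) (λ r → A r (toℕ j))
    colPrefix≡ i' j = trans (sumFin≡sum n _)
      (trans (sum-cong-≗ {n} (colPrefix-term i' j)) (sumBelow-restrict≤ (λ r → A r (toℕ j)) (Finₚ.toℕ<n i')))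

    colPrefix-term : ∀ i' j i → _ ≡ restrict≤ (toℕ i') (λ r → A r (toℕ j)) (toℕ i)
    colPrefix-term i' j i with toℕ i ℕ.≤? toℕ i'
    ... | yes _ = a≡A i j
    ... | no  _ = refl

length-δ : ∀ k → length (δ (suc k)) ≡ k
length-δ zero    = refl
length-δ (suc k) = cong suc (length-δ k)

2+i+lookup-δ : ∀ m i (i<len : i < length (δ m)) → 2 ℕ.+ i ℕ.+ lookup (δ m) (fromℕ< i<len) ≡ suc m
2+i+lookup-δ (suc (suc k)) zero    _           = refl
2+i+lookup-δ (suc (suc k)) (suc i) (s≤s i<len) = cong suc (2+i+lookup-δ (suc k) i i<len)

inPartition-δ⇒ : ∀ m {i j : Fin (suc m)} → InPartition (δ m) (suc m) i j → 2 ℕ.+ toℕ i ≤ toℕ j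
inPartition-δ⇒ m {i} {j} (i<len , 1+m≤j+ℓ) =
  ℕ.+-cancelʳ-≤ ℓ (2 ℕ.+ toℕ i) (toℕ j) (subst (_≤ toℕ j ℕ.+ ℓ) (sym (2+i+lookup-δ m (toℕ i) i<len)) 1+m≤j+ℓ)
  where ℓ = lookup (δ m) (fromℕ< i<len)

inPartition-δ⇐ : ∀ m {i j : Fin (suc m)} → 2 ℕ.+ toℕ i ≤ toℕ j → InPartition (δ m) (suc m) i j
inPartition-δ⇐ zero    {j = j} 2+i≤j = contradiction (ℕ.≤-trans 2+i≤j (ℕ.m<1+n⇒m≤n (Finₚ.toℕ<n j))) λ ()
inPartition-δ⇐ (suc k) {i} {j} 2+i≤j =
  i<len , subst (_≤ toℕ j ℕ.+ ℓ) (2+i+lookup-δ (suc k) (toℕ i) i<len) (ℕ.+-monoˡ-≤ ℓ 2+i≤j)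
  where
  i<len : toℕ i < length (δ (suc k))
  i<len = subst (toℕ i <_) (sym (length-δ k)) (ℕ.≤-pred (ℕ.≤-trans 2+i≤j (ℕ.m<1+n⇒m≤n (Finₚ.toℕ<n j))))
  ℓ = lookup (δ (suc k)) (fromℕ< i<len)

tridiag∈𝒫 : ∀ m {x} → (∀ c → x c ∈[0,1]) → (∀ c → m ≤ c → x c ≡ 0ℚ) →
            (a : Mat (suc m)) → (∀ i j → a i j ≡ tridiag x (toℕ i) (toℕ j)) → 𝒫 (δ m) (suc m) a
tridiag∈𝒫 m {x} x∈[0,1] x≥m≡0 a a≡ = (colPrefix∈ , rowPrefix∈ , rowSum , colSum) , lowerZero , partitionZero
  where
  open SumsOf a (tridiag x) a≡
  transposed : ∀ c → (λ r → tridiag x r c) ≗ tridiag x c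
  transposed c r = tridiag-sym x r c
  colPrefix∈ : ∀ i' j → colPrefix a i' j ∈[0,1]
  colPrefix∈ i' j = subst _∈[0,1]
    (sym (trans (colPrefix≡ i' j) (sumBelow-cong (suc (toℕ i')) (λ r _ → transposed (toℕ j) r))))
    (tridiag-prefix∈[0,1] x∈[0,1] (toℕ j) (toℕ i'))
  rowPrefix∈ : ∀ i j' → rowPrefix a i j' ∈[0,1]
  rowPrefix∈ i j' = subst _∈[0,1] (sym (rowPrefix≡ i j')) (tridiag-prefix∈[0,1] x∈[0,1] (toℕ i) (toℕ j'))
  rowSum : ∀ i → sumFin (suc m) (λ j → a i j) ≡ 1ℚ
  rowSum i = trans (rowSum≡ i) (tridiag-rowSum x≥m≡0 (ℕ.m<1+n⇒m≤n (Finₚ.toℕ<n i)))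
  colSum : ∀ j → sumFin (suc m) (λ i → a i j) ≡ 1ℚ
  colSum j = trans (colSum≡ j) (trans (sumBelow-cong (suc m) (λ r _ → transposed (toℕ j) r))
                                      (tridiag-rowSum x≥m≡0 (ℕ.m<1+n⇒m≤n (Finₚ.toℕ<n j))))
  lowerZero : ∀ i j → 2 ℕ.+ toℕ j ≤ toℕ i → a i j ≡ 0ℚ
  lowerZero i j 2+j≤i = trans (a≡ i j) (tridiag-below x 2+j≤i)
  partitionZero : ∀ i j → InPartition (δ m) (suc m) i j → a i j ≡ 0ℚ
  partitionZero i j i,j∈δ = trans (a≡ i j) (tridiag-above x (inPartition-δ⇒ m i,j∈δ))

module BandedDoublyStochastic {n} (A : ℕ → ℕ → ℚ)
  (lower : ∀ {r c} → 2 ℕ.+ c ≤ r → A r c ≡ 0ℚ) (upper : ∀ {r c} → 2 ℕ.+ r ≤ c → A r c ≡ 0ℚ)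
  (row≥ : ∀ {r} c → n ≤ r → A r c ≡ 0ℚ) (col≥ : ∀ r {c} → n ≤ c → A r c ≡ 0ℚ)
  (rowSum : ∀ r → r < n → sumBelow n (A r) ≡ 1ℚ) (colSum : ∀ c → c < n → sumBelow n (λ r → A r c) ≡ 1ℚ)
  where

  x : ℕ → ℚ
  x c = A c (suc c)

  rowBand : ∀ r → r < n → previous (A r) r + A r r + x r ≡ 1ℚ
  rowBand r r<n = trans
    (sym (sumBelow-wholeBand n (record { left-zero = lower ; right-zero = upper }) (λ _ → col≥ r)))
    (rowSum r r<n)

  colBand : ∀ c → c < n → previous (λ r → A r c) c + A c c + A (suc c) c ≡ 1ℚ
  colBand c c<n = trans
    (sym (sumBelow-wholeBand n (record { left-zero = upper ; right-zero = lower }) (λ _ → row≥ c)))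
    (colSum c c<n)

  mutual
    symmetric : ∀ c → A (suc c) c ≡ x c
    symmetric c with suc c ℕ.<? n
    ... | no  1+c≮n = trans (row≥ c (ℕ.≮⇒≥ 1+c≮n)) (sym (col≥ c (ℕ.≮⇒≥ 1+c≮n)))
    ... | yes 1+c<n = +-cancelˡ (previous (A c) c + A c c) _ _ (begin
      previous (A c) c + A c c + A (suc c) c
        ≡⟨ cong (λ p → p + A c c + A (suc c) c) (sym (previous-transpose c)) ⟩
      previous (λ r → A r c) c + A c c + A (suc c) c   ≡⟨ colBand c c<n ⟩
      1ℚ                                               ≡⟨ sym (rowBand c c<n) ⟩
      previous (A c) c + A c c + x c                   ∎)
      where open ≡-Reasoning
            c<n = ℕ.<-trans (ℕ.n<1+n c) 1+c<n

    previous-transpose : ∀ c → previous (λ r → A r c) c ≡ previous (A c) c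
    previous-transpose zero    = refl
    previous-transpose (suc c) = sym (symmetric c)

  previous-row : ∀ r → previous (A r) r ≡ previous x r
  previous-row zero    = refl
  previous-row (suc r) = symmetric r

  diagonal-entry : ∀ r → r < n → A r r ≡ 1ℚ - previous x r - x r
  diagonal-entry r r<n = begin
    A r r                                            ≡⟨ solve 3 (λ p d s → d := p :+ d :+ s :- p :- s)
                                                                refl (previous x r) (A r r) (x r) ⟩
    previous x r + A r r + x r - previous x r - x r  ≡⟨ cong (λ t → t - previous x r - x r) rowBand′ ⟩
    1ℚ - previous x r - x r                          ∎
    where
    open ≡-Reasoning
    rowBand′ = trans (cong (λ p → p + A r r + x r) (sym (previous-row r))) (rowBand r r<n)

  isTridiag : ∀ r c → r < n → A r c ≡ tridiag x r c
  isTridiag r c r<n = at (band r c) r<n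
    where
    at : ∀ {r c} → Band r c → r < n → A r c ≡ tridiag x r c
    at (diagonal r) r<n = trans (diagonal-entry r r<n) (sym (tridiag-diagonal x r))
    at (super r)    _   = sym (tridiag-super x r)
    at (sub c)      _   = trans (symmetric c) (sym (tridiag-sub x c))
    at (above 2+r≤c) _  = trans (upper 2+r≤c) (sym (tridiag-above x 2+r≤c))
    at (below 2+c≤r) _  = trans (lower 2+c≤r) (sym (tridiag-below x 2+c≤r))

module In𝒫 (m : ℕ) {a : Mat (suc m)} (a∈𝒫 : 𝒫 (δ m) (suc m) a) where

  private
    n = suc m
    A = entry a
    open SumsOf a A (λ i j → sym (entry-toℕ a i j))

    colPrefix∈ : ∀ i' j → colPrefix a i' j ∈[0,1]
    colPrefix∈ = proj₁ (proj₁ a∈𝒫)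
    rowSum≡1 : ∀ i → sumFin n (λ j → a i j) ≡ 1ℚ
    rowSum≡1 = proj₁ (proj₂ (proj₂ (proj₁ a∈𝒫)))
    colSum≡1 : ∀ j → sumFin n (λ i → a i j) ≡ 1ℚ
    colSum≡1 = proj₂ (proj₂ (proj₂ (proj₁ a∈𝒫)))
    lowerZero : ∀ i j → 2 ℕ.+ toℕ j ≤ toℕ i → a i j ≡ 0ℚ
    lowerZero = proj₁ (proj₂ a∈𝒫)
    partitionZero : ∀ i j → InPartition (δ m) n i j → a i j ≡ 0ℚ
    partitionZero = proj₂ (proj₂ a∈𝒫)

    atℕ : (P : ℕ → Set) → (∀ (i : Fin n) → P (toℕ i)) → ∀ r → r < n → P r
    atℕ P P-fin r r<n = subst P (Finₚ.toℕ-fromℕ< r<n) (P-fin (fromℕ< r<n))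

    lower : ∀ {r c} → 2 ℕ.+ c ≤ r → A r c ≡ 0ℚ
    lower = entry-vanishes a (λ r c → 2 ℕ.+ c ≤ r) lowerZero

    upper : ∀ {r c} → 2 ℕ.+ r ≤ c → A r c ≡ 0ℚ
    upper = entry-vanishes a (λ r c → 2 ℕ.+ r ≤ c) (λ i j 2+i≤j → partitionZero i j (inPartition-δ⇐ m 2+i≤j))

    rowSum : ∀ r → r < n → sumBelow n (A r) ≡ 1ℚ
    rowSum = atℕ (λ r → sumBelow n (A r) ≡ 1ℚ) (λ i → trans (sym (rowSum≡ i)) (rowSum≡1 i))

    colSum : ∀ c → c < n → sumBelow n (λ r → A r c) ≡ 1ℚ
    colSum = atℕ (λ c → sumBelow n (λ r → A r c) ≡ 1ℚ) (λ j → trans (sym (colSum≡ j)) (colSum≡1 j))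

    open BandedDoublyStochastic A lower upper (entry-row≥ a) (entry-col≥ a) rowSum colSum

  isTridiagonal : ∀ i j → a i j ≡ tridiag (superdiagonal a) (toℕ i) (toℕ j)
  isTridiagonal i j = trans (sym (entry-toℕ a i j)) (isTridiag (toℕ i) (toℕ j) (Finₚ.toℕ<n i))

  superdiagonal∈[0,1] : ∀ c → superdiagonal a c ∈[0,1]
  superdiagonal∈[0,1] c with suc c ℕ.<? n
  ... | no  1+c≮n = subst _∈[0,1] (sym (entry-col≥ a c (ℕ.≮⇒≥ 1+c≮n))) 0∈[0,1]
  ... | yes 1+c<n = subst _∈[0,1] aboveDiagonal (prefix∈ c (ℕ.<-trans (ℕ.n<1+n c) 1+c<n))
    where
    colPrefix≡′ : ∀ i → colPrefix a i (fromℕ< 1+c<n) ≡ sumBelow (suc (toℕ i)) (λ r' → A r' (suc c))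
    colPrefix≡′ i = trans (colPrefix≡ i (fromℕ< 1+c<n))
                          (cong (λ c' → sumBelow (suc (toℕ i)) (λ r' → A r' c')) (Finₚ.toℕ-fromℕ< 1+c<n))
    prefix∈ : ∀ r → r < n → sumBelow (suc r) (λ r' → A r' (suc c)) ∈[0,1]
    prefix∈ = atℕ (λ r → sumBelow (suc r) (λ r' → A r' (suc c)) ∈[0,1])
                  (λ i → subst _∈[0,1] (colPrefix≡′ i) (colPrefix∈ i (fromℕ< 1+c<n)))
    aboveDiagonal : sumBelow (suc c) (λ r → A r (suc c)) ≡ superdiagonal a c
    aboveDiagonal = sumBelow-toDiagonal (record { left-zero = upper ; right-zero = lower })

tridiag-affine : ∀ m {x} → (∀ c → m ≤ c → x c ≡ 0ℚ) → ∀ r c →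
  sumBelow m (λ k → (tridiag (kronecker k) r c - tridiag (const 0ℚ) r c) * x k) + tridiag (const 0ℚ) r c
    ≡ tridiag x r c
tridiag-affine m {x} x≥m≡0 r c = at (band r c)
  where
  picks : ∀ r → sumBelow m (λ k → kronecker k r * x k) ≡ x r
  picks r = sumBelow-kronecker m r x (x≥m≡0 r)

  previous-picks : ∀ r → sumBelow m (λ k → previous (kronecker k) r * x k) ≡ previous x r
  previous-picks zero    = sumBelow-vanishing m (λ k _ → ℚ.*-zeroˡ (x k))
  previous-picks (suc r) = picks r

  previous-zero : ∀ r → previous (const 0ℚ) r ≡ 0ℚ
  previous-zero zero    = refl
  previous-zero (suc r) = refl

  zeroTerms : sumBelow m (λ k → (0ℚ - 0ℚ) * x k) ≡ 0ℚ
  zeroTerms = sumBelow-vanishing m (λ k _ → ℚ.*-zeroˡ (x k))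

  dropZero : ∀ (e : ℕ → ℚ) → sumBelow m (λ k → (e k - 0ℚ) * x k) ≡ sumBelow m (λ k → e k * x k)
  dropZero e = sumBelow-cong m (λ k _ → cong (_* x k) (ℚ.+-identityʳ (e k)))

  at : ∀ {r c} (b : Band r c) →
       sumBelow m (λ k → (entryAt (kronecker k) b - entryAt (const 0ℚ) b) * x k) + entryAt (const 0ℚ) b
         ≡ entryAt x b
  at (diagonal r) = begin
    sumBelow m (λ k → (entryAt (kronecker k) (diagonal r) - entryAt (const 0ℚ) (diagonal r)) * x k)
      + entryAt (const 0ℚ) (diagonal r)
      ≡⟨ cong₂ _+_ (sumBelow-linear m (- 1ℚ) (- 1ℚ) (λ k → previous (kronecker k) r * x k)
                                                    (λ k → kronecker k r * x k) term)
                   (cong (λ z → 1ℚ - z - 0ℚ) (previous-zero r)) ⟩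
    (- 1ℚ) * sumBelow m (λ k → previous (kronecker k) r * x k) + (- 1ℚ) * sumBelow m (λ k → kronecker k r * x k)
      + (1ℚ - 0ℚ - 0ℚ)
      ≡⟨ cong₂ (λ s t → (- 1ℚ) * s + (- 1ℚ) * t + (1ℚ - 0ℚ - 0ℚ)) (previous-picks r) (picks r) ⟩
    (- 1ℚ) * previous x r + (- 1ℚ) * x r + (1ℚ - 0ℚ - 0ℚ)
      ≡⟨ solve 2 (λ p y → (:- con 1ℚ) :* p :+ (:- con 1ℚ) :* y :+ (con 1ℚ :- con 0ℚ :- con 0ℚ)
                          := con 1ℚ :- p :- y)
               refl (previous x r) (x r) ⟩
    1ℚ - previous x r - x r ∎
    where
    open ≡-Reasoning
    term : ∀ k → (entryAt (kronecker k) (diagonal r) - entryAt (const 0ℚ) (diagonal r)) * x k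
                 ≡ (- 1ℚ) * (previous (kronecker k) r * x k) + (- 1ℚ) * (kronecker k r * x k)
    term k = trans (cong (λ z → (entryAt (kronecker k) (diagonal r) - (1ℚ - z - 0ℚ)) * x k) (previous-zero r))
      (solve 3 (λ p e y → (con 1ℚ :- p :- e :- (con 1ℚ :- con 0ℚ :- con 0ℚ)) :* y
                          := (:- con 1ℚ) :* (p :* y) :+ (:- con 1ℚ) :* (e :* y))
             refl (previous (kronecker k) r) (kronecker k r) (x k))
  at (super r) = trans (ℚ.+-identityʳ _) (trans (dropZero (λ k → kronecker k r)) (picks r))
  at (sub c)   = trans (ℚ.+-identityʳ _) (trans (dropZero (λ k → kronecker k c)) (picks c))
  at (above _) = trans (ℚ.+-identityʳ _) zeroTerms
  at (below _) = trans (ℚ.+-identityʳ _) zeroTerms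

superdiagonalMap : ∀ m → AffMatToVec (suc m) m
superdiagonalMap m = record
  { lin = λ k i j → kronecker (toℕ i) (toℕ k) * kronecker (toℕ j) (suc (toℕ k))
  ; off = λ _ → 0ℚ
  }

applyMV-superdiagonalMap : ∀ m (a : Mat (suc m)) k → applyMV (superdiagonalMap m) a k ≡ superdiagonal a (toℕ k)
applyMV-superdiagonalMap m a k = begin
  sumFin n (λ i → sumFin n (λ j → lin k i j * a i j)) + 0ℚ  ≡⟨ ℚ.+-identityʳ _ ⟩
  sumFin n (λ i → sumFin n (λ j → lin k i j * a i j))       ≡⟨ sumFin≡sum n (λ i → sumFin n (λ j → lin k i j * a i j)) ⟩
  sum (λ i → sumFin n (λ j → lin k i j * a i j))            ≡⟨ sum-cong-≗ {n} row ⟩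
  sumBelow n (λ r → kronecker r K * entry a r (suc K))      ≡⟨ sumBelow-kronecker n K (λ r → entry a r (suc K))
                                                                                  (λ n≤K → entry-row≥ a (suc K) n≤K) ⟩
  entry a K (suc K)                                         ∎
  where
  open ≡-Reasoning
  open AffMatToVec (superdiagonalMap m)
  n = suc m
  K = toℕ k
  row : ∀ i → sumFin n (λ j → lin k i j * a i j) ≡ kronecker (toℕ i) K * entry a (toℕ i) (suc K)
  row i = begin
    sumFin n (λ j → lin k i j * a i j)                          ≡⟨ sumFin≡sum n (λ j → lin k i j * a i j) ⟩
    sum (λ j → lin k i j * a i j)                               ≡⟨ sum-cong-≗ {n} term ⟩
    sumBelow n (λ c → kronecker c (suc K) * (κ * entry a r c))  ≡⟨ sumBelow-kronecker n (suc K) (λ c → κ * entry a r c)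
                                                                                       vanishes ⟩
    κ * entry a r (suc K)                                       ∎
    where
    r = toℕ i
    κ = kronecker r K
    term : ∀ j → lin k i j * a i j ≡ kronecker (toℕ j) (suc K) * (κ * entry a r (toℕ j))
    term j = trans (cong (lin k i j *_) (sym (entry-toℕ a i j)))
                   (solve 3 (λ p q e → p :* q :* e := q :* (p :* e)) refl κ (kronecker (toℕ j) (suc K)) (entry a r (toℕ j)))
    vanishes : n ≤ suc K → κ * entry a r (suc K) ≡ 0ℚ
    vanishes n≤1+K = trans (cong (κ *_) (entry-col≥ a r n≤1+K)) (ℚ.*-zeroʳ κ)

tridiagMap : ∀ m → AffVecToMat m (suc m)
tridiagMap m = record
  { lin = λ i j k → tridiag (kronecker (toℕ k)) (toℕ i) (toℕ j) - tridiag (const 0ℚ) (toℕ i) (toℕ j)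
  ; off = λ i j → tridiag (const 0ℚ) (toℕ i) (toℕ j)
  }

applyVM-tridiagMap : ∀ m (x : Vecℚ m) → MatEq (applyVM (tridiagMap m) x) (tridiagMatrix (extendBy 0ℚ x))
applyVM-tridiagMap m x i j = begin
  sumFin m (λ k → lin i j k * x k) + off i j                      ≡⟨ cong (_+ off i j) (sumFin≡sum m _) ⟩
  sum (λ k → lin i j k * x k) + off i j                           ≡⟨ cong (_+ off i j) (sum-cong-≗ {m} extended) ⟩
  sumBelow m (λ k → lin′ k * extendBy 0ℚ x k) + off i j           ≡⟨ tridiag-affine m (λ c → extendBy-≥ 0ℚ x) (toℕ i) (toℕ j) ⟩
  tridiag (extendBy 0ℚ x) (toℕ i) (toℕ j)                         ∎
  where
  open ≡-Reasoning
  open AffVecToMat (tridiagMap m)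
  lin′ : ℕ → ℚ
  lin′ k = tridiag (kronecker k) (toℕ i) (toℕ j) - tridiag (const 0ℚ) (toℕ i) (toℕ j)
  extended : ∀ k → lin i j k * x k ≡ lin′ (toℕ k) * extendBy 0ℚ x (toℕ k)
  extended k = cong (lin i j k *_) (sym (extendBy-toℕ 0ℚ x k))

cubeEquivalence : ∀ m → AffinelyEquivalent (𝒫 (δ m) (suc m)) (OrderPolytope m (antichain m))
cubeEquivalence m = f , g , toCube , fromCube , fromTo , toFrom
  where
  f = superdiagonalMap m
  g = tridiagMap m

  toCube : ∀ a → 𝒫 (δ m) (suc m) a → OrderPolytope m (antichain m) (applyMV f a)
  toCube a a∈𝒫 =
    (λ k → subst _∈[0,1] (sym (applyMV-superdiagonalMap m a k)) (In𝒫.superdiagonal∈[0,1] m a∈𝒫 (toℕ k))) ,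
    λ { s .s refl → ℚ.≤-refl }

  fromCube : ∀ x → OrderPolytope m (antichain m) x → 𝒫 (δ m) (suc m) (applyVM g x)
  fromCube x (x∈[0,1] , _) =
    tridiag∈𝒫 m (extendBy-preserves _∈[0,1] 0∈[0,1] x∈[0,1]) (λ c → extendBy-≥ 0ℚ x) _ (applyVM-tridiagMap m x)

  fromTo : ∀ a → 𝒫 (δ m) (suc m) a → MatEq (applyVM g (applyMV f a)) a
  fromTo a a∈𝒫 i j = begin
    applyVM g (applyMV f a) i j                        ≡⟨ applyVM-tridiagMap m (applyMV f a) i j ⟩
    tridiagMatrix (extendBy 0ℚ (applyMV f a)) i j      ≡⟨ tridiag-cong superdiagonal≡ (toℕ i) (toℕ j) ⟩
    tridiagMatrix (superdiagonal a) i j                ≡⟨ sym (In𝒫.isTridiagonal m a∈𝒫 i j) ⟩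
    a i j                                              ∎
    where
    open ≡-Reasoning
    superdiagonal≡ = extendBy-unique (applyMV-superdiagonalMap m a) (λ c → superdiagonal-≥ a)

  toFrom : ∀ x → OrderPolytope m (antichain m) x → VecEq (applyMV f (applyVM g x)) x
  toFrom x _ k = begin
    applyMV f (applyVM g x) k                                      ≡⟨ applyMV-superdiagonalMap m (applyVM g x) k ⟩
    superdiagonal (applyVM g x) (toℕ k)                            ≡⟨ entry-cong (applyVM-tridiagMap m x) (toℕ k) (suc (toℕ k)) ⟩
    superdiagonal (tridiagMatrix {suc m} (extendBy 0ℚ x)) (toℕ k)  ≡⟨ superdiagonal-tridiagMatrix (λ c → extendBy-≥ 0ℚ x) (toℕ k) ⟩
    extendBy 0ℚ x (toℕ k)                                          ≡⟨ extendBy-toℕ 0ℚ x k ⟩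
    x k                                                            ∎
    where open ≡-Reasoning

gridPoint : ∀ {m} → ℕ → Vec ℕ m → ℕ → ℚ
gridPoint k w = extendBy 0ℚ (λ i → ℤ.+ Vec.lookup w i / suc k)

gridPoint-≥ : ∀ {m} k (w : Vec ℕ m) {c} → m ≤ c → gridPoint k w c ≡ 0ℚ
gridPoint-≥ k w = extendBy-≥ 0ℚ _

gridPoint∈[0,1] : ∀ {m} k {w : Vec ℕ m} → VecAll.All (_≤ suc k) w → ∀ c → gridPoint k w c ∈[0,1]
gridPoint∈[0,1] k w≤1+k = extendBy-preserves _∈[0,1] 0∈[0,1] (λ i → /∈[0,1]⁺ k (VecAll.lookup⁺ w≤1+k i))

gridPoint-injective : ∀ {m} k {w w' : Vec ℕ m} → (∀ i → gridPoint k w (toℕ i) ≡ gridPoint k w' (toℕ i)) →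
                      w ≡ w'
gridPoint-injective k {w} {w'} same = begin
  w                             ≡⟨ sym (Vec.tabulate∘lookup w) ⟩
  Vec.tabulate (Vec.lookup w)   ≡⟨ Vec.tabulate-cong (λ i → ℤ.+-injective (/-injective k (lookup≡ i))) ⟩
  Vec.tabulate (Vec.lookup w')  ≡⟨ Vec.tabulate∘lookup w' ⟩
  w'                            ∎
  where
  open ≡-Reasoning
  lookup≡ : ∀ i → ℤ.+ Vec.lookup w i / suc k ≡ ℤ.+ Vec.lookup w' i / suc k
  lookup≡ i = trans (sym (extendBy-toℕ 0ℚ _ i)) (trans (same i) (extendBy-toℕ 0ℚ _ i))

gridPoint-complete : ∀ {m} k K {x : ℕ → ℚ} → (∀ c → m ≤ c → x c ≡ 0ℚ) →
                     (∀ (i : Fin m) → ∃ λ v → v ≤ K × x (toℕ i) ≡ ℤ.+ v / suc k) →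
                     ∃ λ w → VecAll.All (_≤ K) w × (∀ c → x c ≡ gridPoint k w c)
gridPoint-complete k K x≥m≡0 onGrid =
  w , VecAll.tabulate⁺ (proj₁ ∘ proj₂ ∘ onGrid) , λ c → sym (extendBy-unique agrees x≥m≡0 c)
  where
  w = Vec.tabulate (proj₁ ∘ onGrid)
  agrees : ∀ i → ℤ.+ Vec.lookup w i / suc k ≡ _
  agrees i = trans (cong (λ v → ℤ.+ v / suc k) (Vec.lookup∘tabulate _ i)) (sym (proj₂ (proj₂ (onGrid i))))

update : (ℕ → ℚ) → ℕ → ℚ → ℕ → ℚ
update x c q c' with c' ℕ.≟ c
... | yes _ = q
... | no  _ = x c'

update-same : ∀ x c q → update x c q c ≡ q
update-same x c q with c ℕ.≟ c
... | yes _   = refl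
... | no  c≢c = contradiction refl c≢c

update-preserves : ∀ (P : ℚ → Set) {x c q} → (∀ c → P (x c)) → P q → ∀ c' → P (update x c q c')
update-preserves P {c = c} Px Pq c' with c' ℕ.≟ c
... | yes _ = Pq
... | no  _ = Px c'

update-≥ : ∀ {m x c} q → c < m → (∀ c → m ≤ c → x c ≡ 0ℚ) → ∀ c' → m ≤ c' → update x c q c' ≡ 0ℚ
update-≥ {c = c} q c<m x≥m≡0 c' m≤c' with c' ℕ.≟ c
... | yes refl = contradiction c<m (ℕ.≤⇒≯ m≤c')
... | no  _    = x≥m≡0 c' m≤c'

update-convex : ∀ x c c' → x c' ≡ x c * update x c 1ℚ c' + (1ℚ - x c) * update x c 0ℚ c'
update-convex x c c' with c' ℕ.≟ c
... | yes refl = solve 1 (λ t → t := t :* con 1ℚ :+ (con 1ℚ :- t) :* con 0ℚ) refl (x c')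
... | no  _    = solve 2 (λ t y → y := t :* y :+ (con 1ℚ :- t) :* y) refl (x c) (x c')

isVertex-tridiag : ∀ m {x} → (∀ c → IsZeroOrOne (x c)) → (∀ c → m ≤ c → x c ≡ 0ℚ) →
                   IsVertex (𝒫 (δ m) (suc m)) (tridiagMatrix x)
isVertex-tridiag m {x} x∈01 x≥m≡0 = tridiag∈𝒫 m (isZeroOrOne⇒∈[0,1] ∘ x∈01) x≥m≡0 _ (λ _ _ → refl) , extreme
  where
  extreme : ∀ y z t → 𝒫 (δ m) (suc m) y → 𝒫 (δ m) (suc m) z → 0ℚ ℚ.< t → t ℚ.< 1ℚ →
            MatEq (tridiagMatrix x) (λ i j → t * y i j + (1ℚ - t) * z i j) → MatEq y (tridiagMatrix x)
  extreme y z t y∈𝒫 z∈𝒫 0<t t<1 x≡ty+[1-t]z i j =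
    trans (In𝒫.isTridiagonal m y∈𝒫 i j) (tridiag-cong superdiagonals-agree (toℕ i) (toℕ j))
    where
    onFin : ∀ (k : Fin m) → superdiagonal y (toℕ k) ≡ x (toℕ k)
    onFin k = extreme-[0,1] (x∈01 (toℕ k)) 0<t t<1 (In𝒫.superdiagonal∈[0,1] m y∈𝒫 (toℕ k))
                            (In𝒫.superdiagonal∈[0,1] m z∈𝒫 (toℕ k))
      (begin
        x (toℕ k)                                        ≡⟨ sym (superdiagonal-tridiagMatrix x≥m≡0 (toℕ k)) ⟩
        superdiagonal (tridiagMatrix {suc m} x) (toℕ k)  ≡⟨ superdiagonal-inject₁ (tridiagMatrix x) k ⟩
        tridiagMatrix x (inject₁ k) (Fin.suc k)     ≡⟨ x≡ty+[1-t]z (inject₁ k) (Fin.suc k) ⟩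
        t * y (inject₁ k) (Fin.suc k) + (1ℚ - t) * z (inject₁ k) (Fin.suc k)
          ≡⟨ sym (cong₂ (λ p q → t * p + (1ℚ - t) * q) (superdiagonal-inject₁ y k) (superdiagonal-inject₁ z k)) ⟩
        t * superdiagonal y (toℕ k) + (1ℚ - t) * superdiagonal z (toℕ k) ∎)
      where open ≡-Reasoning
    superdiagonals-agree : ∀ c → superdiagonal y c ≡ x c
    superdiagonals-agree =
      ≗-belowAndBeyond m onFin (λ c m≤c → trans (superdiagonal-≥ y m≤c) (sym (x≥m≡0 c m≤c)))

-- If 0 < x_c < 1 then v = x_c · T(x[c≔1]) + (1 − x_c) · T(x[c≔0]) with both matrices in 𝒫.
vertex⇒superdiagonal-isZeroOrOne : ∀ m {v} → IsVertex (𝒫 (δ m) (suc m)) v →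
                                   ∀ c → IsZeroOrOne (superdiagonal v c)
vertex⇒superdiagonal-isZeroOrOne m {v} (v∈𝒫 , extreme) c with superdiagonal v c ℚ.≟ 0ℚ | superdiagonal v c ℚ.≟ 1ℚ
... | yes x≡0 | _        = inj₁ x≡0
... | no  _   | yes x≡1  = inj₂ x≡1
... | no  x≢0 | no  x≢1 with c ℕ.<? m
...   | no  c≮m = contradiction (superdiagonal-≥ v (ℕ.≮⇒≥ c≮m)) x≢0
...   | yes c<m = contradiction x≡1 x≢1
  where
  x = superdiagonal v
  t = x c
  x≥m≡0 : ∀ c → m ≤ c → x c ≡ 0ℚ
  x≥m≡0 c = superdiagonal-≥ v

  updated∈𝒫 : ∀ {q} → q ∈[0,1] → 𝒫 (δ m) (suc m) (tridiagMatrix (update x c q))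
  updated∈𝒫 {q} q∈[0,1] = tridiag∈𝒫 m (update-preserves _∈[0,1] (In𝒫.superdiagonal∈[0,1] m v∈𝒫) q∈[0,1])
                                      (update-≥ q c<m x≥m≡0) _ (λ _ _ → refl)

  strictly : 0ℚ ℚ.< t × t ℚ.< 1ℚ
  strictly with In𝒫.superdiagonal∈[0,1] m v∈𝒫 c
  ... | 0≤t , t≤1 = ≤∧≢⇒< 0≤t (x≢0 ∘ sym) , ≤∧≢⇒< t≤1 x≢1

  raised≡v : MatEq (tridiagMatrix (update x c 1ℚ)) v
  raised≡v = extreme _ _ t (updated∈𝒫 1∈[0,1]) (updated∈𝒫 0∈[0,1]) (proj₁ strictly) (proj₂ strictly)
    (λ i j → trans (In𝒫.isTridiagonal m v∈𝒫 i j) (tridiag-convex t (update-convex x c) (toℕ i) (toℕ j)))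

  x≡1 : x c ≡ 1ℚ
  x≡1 = begin
    x c                                                    ≡⟨ sym (entry-cong raised≡v c (suc c)) ⟩
    superdiagonal (tridiagMatrix {suc m} (update x c 1ℚ)) c ≡⟨ superdiagonal-tridiagMatrix (update-≥ 1ℚ c<m x≥m≡0) c ⟩
    update x c 1ℚ c                                        ≡⟨ update-same x c 1ℚ ⟩
    1ℚ                                                     ∎
    where open ≡-Reasoning

vertexCount : ∀ m → NumVertices (𝒫 (δ m) (suc m)) (2 ^ m)
vertexCount m = HasExactly-map (tridiagMatrix ∘ gridPoint 0) injective sound complete (box-exactly m 1)
  where
  injective : ∀ {w w'} → MatEq (tridiagMatrix (gridPoint 0 w)) (tridiagMatrix (gridPoint 0 w')) → w ≡ w'
  injective {w} {w'} same = gridPoint-injective 0 (λ i →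
    tridiagMatrix-injective (λ c → gridPoint-≥ 0 w) (λ c → gridPoint-≥ 0 w') same (toℕ i))

  bit : ∀ {v} → v ≤ 1 → IsZeroOrOne (ℤ.+ v / 1)
  bit z≤n       = inj₁ refl
  bit (s≤s z≤n) = inj₂ refl

  sound : ∀ {w} → VecAll.All (_≤ 1) w → IsVertex (𝒫 (δ m) (suc m)) (tridiagMatrix (gridPoint 0 w))
  sound {w} w≤1 =
    isVertex-tridiag m (extendBy-preserves IsZeroOrOne (inj₁ refl) (bit ∘ VecAll.lookup⁺ w≤1)) (λ c → gridPoint-≥ 0 w)

  asBit : ∀ {q} → IsZeroOrOne q → ∃ λ v → v ≤ 1 × q ≡ ℤ.+ v / 1
  asBit (inj₁ refl) = 0 , z≤n , refl
  asBit (inj₂ refl) = 1 , s≤s z≤n , refl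

  complete : ∀ {v} → IsVertex (𝒫 (δ m) (suc m)) v →
             ∃ λ w → VecAll.All (_≤ 1) w × MatEq v (tridiagMatrix (gridPoint 0 w))
  complete {v} v-vertex@(v∈𝒫 , _) = onGrid (gridPoint-complete 0 1 (λ c → superdiagonal-≥ v)
    (λ i → asBit (vertex⇒superdiagonal-isZeroOrOne m v-vertex (toℕ i))))
    where
    onGrid : (∃ λ w → VecAll.All (_≤ 1) w × (∀ c → superdiagonal v c ≡ gridPoint 0 w c)) →
             ∃ λ w → VecAll.All (_≤ 1) w × MatEq v (tridiagMatrix (gridPoint 0 w))
    onGrid (w , w≤1 , x≡) =
      w , w≤1 , λ i j → trans (In𝒫.isTridiagonal m v∈𝒫 i j) (tridiag-cong x≡ (toℕ i) (toℕ j))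

module Scaled (k : ℕ) = Tridiagonal ℤ.0ℤ (ℤ.+ suc k) ℤ._-_

scaled/ : ∀ k y r c → Scaled.tridiag k y r c / suc k ≡ tridiag (λ c → y c / suc k) r c
scaled/ k y r c = at (band r c)
  where
  previous/ : ∀ r → Scaled.previous k y r / suc k ≡ previous (λ c → y c / suc k) r
  previous/ zero    = ℚ.0/n≡0 (suc k)
  previous/ (suc r) = refl

  at : ∀ {r c} (b : Band r c) → Scaled.entryAt k y b / suc k ≡ entryAt (λ c → y c / suc k) b
  at (diagonal r) = begin
    (ℤ.+ suc k ℤ.- p ℤ.- y r) / suc k           ≡⟨ /-distrib-sub k (ℤ.+ suc k ℤ.- p) (y r) ⟩
    (ℤ.+ suc k ℤ.- p) / suc k - y r / suc k     ≡⟨ cong (_- y r / suc k) (/-distrib-sub k (ℤ.+ suc k) p) ⟩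
    ℤ.+ suc k / suc k - p / suc k - y r / suc k ≡⟨ cong₂ (λ s p → s - p - y r / suc k) (n/n≡1 k) (previous/ r) ⟩
    1ℚ - previous (λ c → y c / suc k) r - y r / suc k ∎
    where
    open ≡-Reasoning
    p = Scaled.previous k y r
  at (super r) = refl
  at (sub c)   = refl
  at (above _) = ℚ.0/n≡0 (suc k)
  at (below _) = ℚ.0/n≡0 (suc k)

scaledMatrix : ∀ {m} k → Vec ℕ m → IntMat (suc m)
scaledMatrix k w i j = Scaled.tridiag k (extendBy ℤ.0ℤ (λ i → ℤ.+ Vec.lookup w i)) (toℕ i) (toℕ j)

scaledMatrix/ : ∀ {m} k (w : Vec ℕ m) i j →
                scaledMatrix k w i j / suc k ≡ tridiagMatrix (gridPoint k w) i j
scaledMatrix/ k w i j =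
  trans (scaled/ k _ (toℕ i) (toℕ j))
        (tridiag-cong (extendBy-map (_/ suc k) (ℚ.0/n≡0 (suc k)) (λ i → ℤ.+ Vec.lookup w i)) (toℕ i) (toℕ j))

latticeCount : ∀ m k → LatticeCount (𝒫 (δ m) (suc m)) k (suc (suc k) ^ m)
latticeCount m k = HasExactly-map (scaledMatrix k) injective sound complete (box-exactly m (suc k))
  where
  injective : ∀ {w w'} → (∀ i j → scaledMatrix k w i j ≡ scaledMatrix k w' i j) → w ≡ w'
  injective {w} {w'} same = gridPoint-injective k (λ i →
    tridiagMatrix-injective (λ c → gridPoint-≥ k w) (λ c → gridPoint-≥ k w') divided (toℕ i))
    where
    divided : MatEq (tridiagMatrix (gridPoint k w)) (tridiagMatrix (gridPoint k w'))
    divided i j = trans (sym (scaledMatrix/ k w i j)) (trans (cong (_/ suc k) (same i j)) (scaledMatrix/ k w' i j))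

  sound : ∀ {w} → VecAll.All (_≤ suc k) w → InDilate (𝒫 (δ m) (suc m)) k (scaledMatrix k w)
  sound {w} w≤1+k = tridiag∈𝒫 m (gridPoint∈[0,1] k w≤1+k) (λ c → gridPoint-≥ k w) _ (scaledMatrix/ k w)

  complete : ∀ {z} → InDilate (𝒫 (δ m) (suc m)) k z →
             ∃ λ w → VecAll.All (_≤ suc k) w × (∀ i j → z i j ≡ scaledMatrix k w i j)
  complete {z} z∈𝒫 = onGrid (gridPoint-complete k (suc k) (λ c → superdiagonal-≥ a) numerator)
    where
    a : Mat (suc m)
    a i j = z i j / suc k

    numerator : ∀ i → ∃ λ v → v ≤ suc k × superdiagonal a (toℕ i) ≡ ℤ.+ v / suc k
    numerator i with /∈[0,1]⁻ k (z (inject₁ i) (Fin.suc i))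
                       (subst _∈[0,1] (superdiagonal-inject₁ a i) (In𝒫.superdiagonal∈[0,1] m z∈𝒫 (toℕ i)))
    ... | v , z≡v , v≤1+k = v , v≤1+k , trans (superdiagonal-inject₁ a i) (cong (_/ suc k) z≡v)

    onGrid : (∃ λ w → VecAll.All (_≤ suc k) w × (∀ c → superdiagonal a c ≡ gridPoint k w c)) →
             ∃ λ w → VecAll.All (_≤ suc k) w × (∀ i j → z i j ≡ scaledMatrix k w i j)
    onGrid (w , w≤1+k , x≡) = w , w≤1+k , λ i j → /-injective k (begin
      z i j / suc k                              ≡⟨ In𝒫.isTridiagonal m z∈𝒫 i j ⟩
      tridiagMatrix (superdiagonal a) i j        ≡⟨ tridiag-cong x≡ (toℕ i) (toℕ j) ⟩
      tridiagMatrix (gridPoint k w) i j          ≡⟨ sym (scaledMatrix/ k w i j) ⟩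
      scaledMatrix k w i j / suc k               ∎)
      where open ≡-Reasoning

latticeCount-unique : ∀ m k {N} → LatticeCount (𝒫 (δ m) (suc m)) k N → N ≡ suc (suc k) ^ m
latticeCount-unique m k count = HasExactly-unique count (latticeCount m k)
  where open Pigeonhole (λ z≡w i j → sym (z≡w i j)) (λ z≡w w≡u i j → trans (z≡w i j) (w≡u i j))

relativeVolume : ∀ m → RelVolume (𝒫 (δ m) (suc m)) m 1ℚ
relativeVolume m = ℚ.positive⁻¹ 1ℚ , (λ k → _ , latticeCount m k) , converges
  where
  converges : ∀ ε → 0ℚ ℚ.< ε → ∃ λ K → ∀ k N → K ≤ k → LatticeCount (𝒫 (δ m) (suc m)) k N →
              ℚ.∣ ℕtoℚ N - 1ℚ * ℕtoℚ (suc k ^ m) ∣ ℚ.< ε * ℕtoℚ (suc k ^ m)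
  converges ε 0<ε = ℚ.↧ₙ ε ℕ.* 3 ^ m , λ k N K≤k count →
    subst (λ N → ℚ.∣ ℕtoℚ N - 1ℚ * ℕtoℚ (suc k ^ m) ∣ ℚ.< ε * ℕtoℚ (suc k ^ m))
          (sym (latticeCount-unique m k count)) (gap k K≤k)
    where
    gap : ∀ k → ℚ.↧ₙ ε ℕ.* 3 ^ m ≤ k →
          ℚ.∣ ℕtoℚ (suc (suc k) ^ m) - 1ℚ * ℕtoℚ (suc k ^ m) ∣ ℚ.< ε * ℕtoℚ (suc k ^ m)
    gap k K≤k = begin-strict
      ℚ.∣ ℕtoℚ B - 1ℚ * ℕtoℚ A ∣ ≡⟨ cong (λ a → ℚ.∣ ℕtoℚ B - a ∣) (ℚ.*-identityˡ (ℕtoℚ A)) ⟩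
      ℚ.∣ ℕtoℚ B - ℕtoℚ A ∣      ≡⟨ cong ℚ.∣_∣ (ℕtoℚ-∸ (ℕ.^-monoˡ-≤ m (ℕ.n≤1+n (suc k)))) ⟩
      ℚ.∣ ℕtoℚ (B ∸ A) ∣         ≡⟨ ℚ.0≤p⇒∣p∣≡p (ℚ.nonNegative⁻¹ (ℕtoℚ (B ∸ A)) {{ℚ.normalize-nonNeg (B ∸ A) 1}}) ⟩
      ℕtoℚ (B ∸ A)               <⟨ ℕtoℚ<ε* 0<ε (B ∸ A) A (pow-suc-gap m (ℚ.↧ₙ ε) k K≤k) ⟩
      ε * ℕtoℚ A                 ∎
      where
      open ℚ.≤-Reasoning
      A = suc k ^ m
      B = suc (suc k) ^ m

normalizedVolume : ∀ m → NormalizedVolume (𝒫 (δ m) (suc m)) (ℕtoℚ (m !))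
normalizedVolume m = m , 1ℚ , relativeVolume m , sym (ℚ.*-identityʳ (ℕtoℚ (m !)))

corollary4p8 : (n : ℕ) → 1 ≤ n →
    AffinelyEquivalent (𝒫 (δ (n ∸ 1)) n) (OrderPolytope (n ∸ 1) (antichain (n ∸ 1))) ×
    NumVertices (𝒫 (δ (n ∸ 1)) n) (2 ^ (n ∸ 1)) ×
    NormalizedVolume (𝒫 (δ (n ∸ 1)) n) (ℕtoℚ ((n ∸ 1) !))
corollary4p8 (suc m) _ = cubeEquivalence m , vertexCount m , normalizedVolume m
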